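{- Let $S,T\subseteq[\Delta]^2$ be multisets with $|S|=|T|=n$, no point of $S$ sharing a location with a point of $T$, and let $k$ be the minimum of the number of distinct points of $S$ and the number of distinct points of $T$. For each level $i=0,\ldots,\log\Delta$ and each $j=1,\ldots,2\log\Delta$, let $G_i^j$ be a grid of cell size $2^i$ shifted by some vector with half-integral coordinates. Let $C_i^j=\|V_{G_i^j}(S)-V_{G_i^j}(T)\|_1$, $C_i=\min_j C_i^j$, and $Y=\frac12\sum_{i=0}^{\log\Delta}2^i C_i$. Then $Y\ge\Omega\!\left(\frac{1}{k^2}\right)\cdot EMD(S,T)$.
   Context: $[\Delta]=\{1,\ldots,\Delta\}$ and logarithms are base 2. For multisets $S,T$ with $|S|=|T|=n$, $EMD(S,T)=\min_{\pi:S\to T}\sum_{a\in S}\|a-\pi(a)\|_1$ over bijections $\pi$. A grid of cell size $2^i$ is the family of square cells of side length $2^i$ obtained from the axis-parallel grid with lines at coordinates that are multiples of $2^i$ (fixed at the origin) by translating it by a shift vector; shift vectors have half-integral coordinates (in $\{\ldots,-\tfrac12,\tfrac12,\tfrac32,\ldots\}$), so that all grid lines have half-integral coordinates and no point of $[\Delta]^2$ lies on a grid line. For a grid $G$ and multiset $S\subseteq[\Delta]^2$, the characteristic vector $V_G(S)$ has one coordinate for each cell of $G$ intersecting $(0,\Delta)^2$, whose value is the number of points of $S$ (with multiplicity) in that cell. -}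

module Defs where

open import Data.Nat using (ℕ; zero; suc; _+_; _*_; _^_; _⊓_; _≤_; ∣_-_∣)
open import Data.Nat.Properties using (m^n≢0) renaming (_≟_ to _≟ℕ_)
open import Data.Integer using (ℤ; +_) renaming (_+_ to _+ℤ_; _-_ to _-ℤ_; -_ to negℤ; ∣_∣ to absℤ)
open import Data.Integer.DivMod using (_/ℕ_)
import Data.Integer.Properties as ℤP
open import Data.Product using (_×_; _,_)
open import Data.Product.Properties using (≡-dec)
open import Data.List using (List; []; _∷_; map; concatMap; foldr; zipWith; length; filter; upTo; deduplicate)
open import Data.Nat.ListAction using (sum)
open import Relation.Binary.PropositionalEquality using (_≡_)
open import Relation.Binary.Definitions using (DecidableEquality)

Point : Set
Point = ℕ × ℕ

InBox : ℕ → Point → Set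
InBox Δ (x , y) = (1 ≤ x × x ≤ Δ) × (1 ≤ y × y ≤ Δ)

-- Multisets of points are represented as lists (order irrelevant,
-- multiplicity = number of occurrences).

_≟P_ : DecidableEquality Point
_≟P_ = ≡-dec _≟ℕ_ _≟ℕ_

distinct : List Point → ℕ
distinct S = length (deduplicate _≟P_ S)

dist : Point → Point → ℕ
dist (a , b) (c , d) = ∣ a - c ∣ + ∣ b - d ∣

insertAll : {A : Set} → A → List A → List (List A)
insertAll x [] = (x ∷ []) ∷ []
insertAll x (y ∷ ys) = (x ∷ y ∷ ys) ∷ map (y ∷_) (insertAll x ys)

perms : {A : Set} → List A → List (List A)
perms [] = [] ∷ []
perms (x ∷ xs) = concatMap (insertAll x) (perms xs)

-- minimum of a list (0 for the empty list; never used on empty lists below)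
minList : List ℕ → ℕ
minList [] = 0
minList (x ∷ xs) = foldr _⊓_ x xs

matchCost : List Point → List Point → ℕ
matchCost S T' = sum (zipWith dist S T')

-- EMD(S,T) = min over bijections π : S → T of Σ ‖a - π a‖₁
-- (bijections between the multisets = reorderings T' of T matched
--  positionally with S; meaningful when |S| = |T|).
EMD : List Point → List Point → ℕ
EMD S T = minList (map (matchCost S) (perms T))

-- A grid of cell size 2^i with shift vector (sx + 1/2 , sy + 1/2),
-- where (sx , sy) ∈ ℤ²: its grid lines are at 2^i·m + s + 1/2, m ∈ ℤ.
-- The cell with index m (per axis) is the open interval
--   (2^i·m + s + 1/2 , 2^i·(m+1) + s + 1/2).
Shift : Set
Shift = ℤ × ℤ

-- index (per axis) of the cell containing the integer coordinate p:
-- ⌊(p - s - 1/2) / 2^i⌋ = ⌊(p - s - 1) / 2^i⌋  (floor division)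
cellIdx : ℕ → ℤ → ℕ → ℤ
cellIdx i s p = ((+ p -ℤ s) -ℤ + 1) /ℕ (2 ^ i)
  where instance _ = m^n≢0 2 i

Cell : Set
Cell = ℤ × ℤ

cellOf : ℕ → Shift → Point → Cell
cellOf i (sx , sy) (x , y) = cellIdx i sx x , cellIdx i sy y

_≟C_ : DecidableEquality Cell
_≟C_ = ≡-dec ℤP._≟_ ℤP._≟_

cellCount : ℕ → Shift → List Point → Cell → ℕ
cellCount i sh S c = length (filter (λ p → cellOf i sh p ≟C c) S)

-- per axis, the indices m of the cells meeting the open interval (0,Δ):
--   2^i·m + s + 1/2 < Δ   ⇔  m ≤ ⌊(Δ - 1 - s) / 2^i⌋ = hi
--   2^i·(m+1) + s + 1/2 > 0 ⇔ m ≥ -⌊s / 2^i⌋ - 1 = lo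
axisRange : ℕ → ℕ → ℤ → List ℤ
axisRange Δ i s = map (λ t → lo +ℤ + t) (upTo (suc (absℤ (hi -ℤ lo))))
  where
  instance _ = m^n≢0 2 i
  lo hi : ℤ
  lo = negℤ (s /ℕ (2 ^ i)) -ℤ + 1
  hi = ((+ Δ -ℤ + 1) -ℤ s) /ℕ (2 ^ i)

-- the cells of the grid that intersect (0,Δ)²  (the coordinates of V_G)
gridCells : ℕ → ℕ → Shift → List Cell
gridCells Δ i (sx , sy) =
  concatMap (λ mx → map (λ my → (mx , my)) (axisRange Δ i sy)) (axisRange Δ i sx)

gridDiff : ℕ → ℕ → Shift → List Point → List Point → ℕ
gridDiff Δ i sh S T =
  sum (map (λ c → ∣ cellCount i sh S c - cellCount i sh T c ∣) (gridCells Δ i sh))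

-- The estimator  (with Δ = 2^L, so log Δ = L)

Cmin : ℕ → (ℕ → ℕ → Shift) → List Point → List Point → ℕ → ℕ
Cmin L shift S T i =
  minList (map (λ j → gridDiff (2 ^ L) i (shift i (suc j)) S T) (upTo (2 * L)))

twoY : ℕ → (ℕ → ℕ → Shift) → List Point → List Point → ℕ
twoY L shift S T = sum (map (λ i → 2 ^ i * Cmin L shift S T i) (upTo (suc L)))

module Submission where

open import Defs
open import Data.Nat using (ℕ; _*_; _^_; _≤_; _⊓_)
open import Data.Product using (∃-syntax)
open import Data.List using (List; length)
open import Data.List.Relation.Unary.All using (All)
open import Data.List.Membership.Propositional using (_∉_)
open import Relation.Binary.PropositionalEquality using (_≡_)

open import Data.Nat.Base
open import Data.Nat.Properties
open import Data.Nat.ListAction using (sum)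
open import Data.Nat.ListAction.Properties using (sum-++; sum-↭)
open import Data.Nat.Tactic.RingSolver using (solve-∀)
import Data.Integer.Base as ℤ
import Data.Integer.Properties as ℤP
import Data.Integer.DivMod as ℤDivMod
import Data.Integer.Tactic.RingSolver as ℤ-Ring
open import Data.Bool.Base using (Bool; true; false; not; _∧_)
import Data.Bool.Properties as Boolₚ
open import Data.Product.Base as Product using (_×_; _,_; proj₁; proj₂; ∃; ∃₂)
open import Data.Sum.Base as Sum using (_⊎_; inj₁; inj₂; [_,_]′)
open import Data.Empty using (⊥; ⊥-elim)
open import Function.Base using (_∘_)
open import Data.List.Base
  using ([]; _∷_; _++_; [_]; map; filter; concatMap; zip; drop; foldr; upTo; _∷ʳ_; deduplicate)
open import Data.List.Properties
  using ( map-++; map-∘; filter-accept; filter-reject; ++-assoc; ++-identityʳ; concatMap-++; concatMap-map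
        ; map-concatMap; concatMap-pure; length-map; length-++; length-++-≤ˡ; length-zipWith; upTo-∷ʳ)
open import Data.List.Membership.Propositional using (_∈_; find)
open import Data.List.Membership.Propositional.Properties
  using ( ∈-map⁺; ∈-map⁻; ∈-++⁺ˡ; ∈-++⁺ʳ; ∈-++⁻; ∈-∃++; ∈-concatMap⁺; ∈-concatMap⁻; ∈-filter⁺; ∈-filter⁻
        ; ∈-deduplicate⁺; ∈-deduplicate⁻; ∈-upTo⁺; ∈-upTo⁻)
import Data.List.Membership.DecPropositional as DecMembership
open import Data.List.Relation.Unary.Any as Any using (here; there)
import Data.List.Relation.Unary.All as All
import Data.List.Relation.Unary.AllPairs as AllPairs
open import Data.List.Relation.Unary.Unique.Propositional using (Unique)
open import Data.List.Relation.Unary.Unique.DecPropositional.Properties using (deduplicate-!)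
open import Data.List.Relation.Binary.Disjoint.Propositional using (Disjoint)
open import Data.List.Relation.Binary.Permutation.Propositional
  using (_↭_; ↭-refl; ↭-sym; ↭-trans; ↭-reflexive; prep; swap; ↭⇒↭ₛ; module PermutationReasoning)
import Data.List.Relation.Binary.Permutation.Propositional as ↭
import Data.List.Relation.Binary.Permutation.Propositional.Properties as Perm
import Data.List.Relation.Binary.Permutation.Setoid.Properties as PermSetoid
open import Data.List.Extrema.Nat using (argmin; f[argmin]≤f[⊤]; f[argmin]≤f[xs]; argmin-all)
open import Relation.Binary.PropositionalEquality hiding ([_])
open import Relation.Binary.Definitions using (DecidableEquality)
open import Relation.Nullary using (¬_; Dec; yes; no; does; ¬?)
open import Relation.Nullary.Decidable using (dec-true)
open import Relation.Unary using (Pred; Decidable)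
open import Level using (0ℓ)

-- Only one property of 2Y is used (GridBound): it dominates, level by
-- level, every common lower bound of the grid differences over all shifts.
-- The geometric core is the separation lemma: if the points are coloured so
-- that differently coloured points are ≥ 2·2^i - 1 apart, no cell of size 2^i
-- mixes colours, so every grid of that size sees the colour imbalance.  Let A
-- be the side with k sites (distinct locations) and B the other side.  Moving
-- each b ∈ B to its nearest site costs Σρ ≤ 3Y (a dyadic layer-cake sum over
-- levels), and a set of sites at distance ≥ δ from the others has imbalance·δ
-- ≤ 8Y.  Single-linkage clustering of the sites then merges the two closest
-- clusters k - 1 times, matching their unmatched points at cost ≤ (k - 1)·8Y
-- per merge; the result is a perfect matching of cost ≤ 3Y + 8(k - 1)²Y.

private variable A B : Set

∈-delete : ∀ {z x : A} ys zs → z ∈ ys ++ x ∷ zs → z ≢ x → z ∈ ys ++ zs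
∈-delete []       zs (here refl) z≢x = ⊥-elim (z≢x refl)
∈-delete []       zs (there p)   _   = p
∈-delete (y ∷ ys) zs (here refl) _   = here refl
∈-delete (y ∷ ys) zs (there p)   z≢x = there (∈-delete ys zs p z≢x)

∈-absorb : ∀ {x z : A} {xs} → x ∈ xs → z ∈ x ∷ xs → z ∈ xs
∈-absorb x∈xs (here refl) = x∈xs
∈-absorb _    (there z∈)  = z∈

∈-drop : ∀ n {xs : List A} {x} → x ∈ drop n xs → x ∈ xs
∈-drop zero    p = p
∈-drop (suc n) {y ∷ xs} p = there (∈-drop n p)

∈⇒1≤length : ∀ {xs : List A} {x} → x ∈ xs → 1 ≤ length xs
∈⇒1≤length {xs = _ ∷ _} _ = s≤s z≤n

nonempty⇒∈ : ∀ {xs : List A} → 1 ≤ length xs → ∃ λ x → x ∈ xs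
nonempty⇒∈ {xs = x ∷ _} _ = x , here refl

both-empty : ∀ {xs ys : List A} → xs ≡ [] ⊎ ys ≡ [] → length xs ≡ length ys → xs ≡ [] × ys ≡ []
both-empty {xs = []}    {[]}    _         _  = refl , refl
both-empty {xs = _ ∷ _} {[]}    _         ()
both-empty {xs = []}    {_ ∷ _} _         ()
both-empty {xs = _ ∷ _} {_ ∷ _} (inj₁ ()) _
both-empty {xs = _ ∷ _} {_ ∷ _} (inj₂ ()) _

Unique-resp-↭ : ∀ {xs ys : List A} → xs ↭ ys → Unique xs → Unique ys
Unique-resp-↭ p = PermSetoid.Unique-resp-↭ (setoid _) (↭⇒↭ₛ p)

Unique-++-disjoint : ∀ (xs : List A) {ys} → Unique (xs ++ ys) → Disjoint xs ys
Unique-++-disjoint (x ∷ xs) (x∉ AllPairs.∷ _) (here refl , x∈ys) = All.lookup x∉ (∈-++⁺ʳ xs x∈ys) refl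
Unique-++-disjoint (x ∷ xs) (_ AllPairs.∷ u)  (there v∈xs , v∈ys) = Unique-++-disjoint xs u (v∈xs , v∈ys)

concatMap-↭ : ∀ (f : A → List B) {xs ys} → xs ↭ ys → concatMap f xs ↭ concatMap f ys
concatMap-↭ f ↭.refl          = ↭-refl
concatMap-↭ f (prep x p)      = Perm.++⁺ˡ (f x) (concatMap-↭ f p)
concatMap-↭ f (swap x y p)    = ↭-trans (Perm.shifts (f x) (f y)) (Perm.++⁺ˡ (f y) (Perm.++⁺ˡ (f x) (concatMap-↭ f p)))
concatMap-↭ f (↭.trans p q)   = ↭-trans (concatMap-↭ f p) (concatMap-↭ f q)

concatMap-split : ∀ (f g h : A → List B) xs → (∀ x → f x ++ g x ≡ h x) →
                  concatMap f xs ++ concatMap g xs ↭ concatMap h xs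
concatMap-split f g h []       split = ↭-refl
concatMap-split f g h (x ∷ xs) split = begin
  (f x ++ F) ++ (g x ++ G)   ↭⟨ Perm.++-assoc (f x) F (g x ++ G) ⟩
  f x ++ (F ++ (g x ++ G))   ↭⟨ Perm.++⁺ˡ (f x) (Perm.shifts F (g x)) ⟩
  f x ++ (g x ++ (F ++ G))   ↭⟨ Perm.++-assoc (f x) (g x) (F ++ G) ⟨
  (f x ++ g x) ++ (F ++ G)   ≡⟨ cong (_++ (F ++ G)) (split x) ⟩
  h x ++ (F ++ G)            ↭⟨ Perm.++⁺ˡ (h x) (concatMap-split f g h xs split) ⟩
  h x ++ concatMap h xs      ∎
  where
  open PermutationReasoning
  F = concatMap f xs
  G = concatMap g xs

↭-front₂ : ∀ {xs : List A} {x y} → x ∈ xs → y ∈ xs → y ≢ x → ∃ λ rest → xs ↭ x ∷ y ∷ rest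
↭-front₂ {x = x} {y} x∈ y∈ y≢x with ∈-∃++ x∈
... | us , vs , refl with ∈-∃++ (∈-delete us vs y∈ y≢x)
...   | us' , vs' , us++vs≡ =
  us' ++ vs' , ↭-trans (Perm.shift x us vs) (prep x (↭-trans (↭-reflexive us++vs≡) (Perm.shift y us' vs')))

insertAll-complete : ∀ (x : A) ys zs → ys ++ x ∷ zs ∈ insertAll x (ys ++ zs)
insertAll-complete x []       []       = here refl
insertAll-complete x []       (z ∷ zs) = here refl
insertAll-complete x (y ∷ ys) zs       = there (∈-map⁺ (y ∷_) (insertAll-complete x ys zs))

perms-complete : ∀ (xs ys : List A) → ys ↭ xs → ys ∈ perms xs
perms-complete []       ys p rewrite Perm.↭-empty-inv p = here refl
perms-complete (x ∷ xs) ys p with ∈-∃++ (Perm.∈-resp-↭ (↭-sym p) (here refl))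
... | us , vs , refl =
  ∈-concatMap⁺ (insertAll x) (Any.map (λ { refl → insertAll-complete x us vs })
                                      (perms-complete xs (us ++ vs) (Perm.drop-mid us [] p)))

zip-drop₁ : ∀ (xs : List A) (ys : List B) → map proj₁ (zip xs ys) ++ drop (length ys) xs ≡ xs
zip-drop₁ []       []       = refl
zip-drop₁ []       (y ∷ ys) = refl
zip-drop₁ (x ∷ xs) []       = refl
zip-drop₁ (x ∷ xs) (y ∷ ys) = cong (x ∷_) (zip-drop₁ xs ys)

zip-drop₂ : ∀ (xs : List A) (ys : List B) → map proj₂ (zip xs ys) ++ drop (length xs) ys ≡ ys
zip-drop₂ []       ys       = refl
zip-drop₂ (x ∷ xs) []       = refl
zip-drop₂ (x ∷ xs) (y ∷ ys) = cong (y ∷_) (zip-drop₂ xs ys)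

length-zip-drop₁ : ∀ (xs : List A) (ys : List B) → length (zip xs ys) + length (drop (length ys) xs) ≡ length xs
length-zip-drop₁ xs ys = trans (cong (_+ length (drop (length ys) xs)) (sym (length-map proj₁ (zip xs ys))))
                               (trans (sym (length-++ (map proj₁ (zip xs ys)))) (cong length (zip-drop₁ xs ys)))

length-zip-drop₂ : ∀ (xs : List A) (ys : List B) → length (zip xs ys) + length (drop (length xs) ys) ≡ length ys
length-zip-drop₂ xs ys = trans (cong (_+ length (drop (length xs) ys)) (sym (length-map proj₂ (zip xs ys))))
                               (trans (sym (length-++ (map proj₂ (zip xs ys)))) (cong length (zip-drop₂ xs ys)))

zip-drop-either : ∀ (xs : List A) (ys : List B) → drop (length ys) xs ≡ [] ⊎ drop (length xs) ys ≡ []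
zip-drop-either []       []       = inj₁ refl
zip-drop-either []       (y ∷ ys) = inj₁ refl
zip-drop-either (x ∷ xs) []       = inj₂ refl
zip-drop-either (x ∷ xs) (y ∷ ys) = zip-drop-either xs ys

∈-zip⁻ : ∀ {xs : List A} {ys : List B} {a b} → (a , b) ∈ zip xs ys → a ∈ xs × b ∈ ys
∈-zip⁻ {xs = x ∷ xs} {y ∷ ys} (here refl) = here refl , here refl
∈-zip⁻ {xs = x ∷ xs} {y ∷ ys} (there p)   = let a∈ , b∈ = ∈-zip⁻ p in there a∈ , there b∈

minList≤ : ∀ {xs x} → x ∈ xs → minList xs ≤ x
minList≤ {y ∷ ys} (here refl) = foldr-⊓≤init ys
  where
  foldr-⊓≤init : ∀ zs → foldr _⊓_ y zs ≤ y
  foldr-⊓≤init []       = ≤-refl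
  foldr-⊓≤init (z ∷ zs) = ≤-trans (m⊓n≤n z _) (foldr-⊓≤init zs)
minList≤ {y ∷ ys} (there x∈ys) = foldr-⊓≤∈ ys x∈ys
  where
  foldr-⊓≤∈ : ∀ zs {x} → x ∈ zs → foldr _⊓_ y zs ≤ x
  foldr-⊓≤∈ (z ∷ zs) (here refl) = m⊓n≤m z _
  foldr-⊓≤∈ (z ∷ zs) (there p)   = ≤-trans (m⊓n≤n z _) (foldr-⊓≤∈ zs p)

≤minList : ∀ {v} xs → 0 < length xs → (∀ {x} → x ∈ xs → v ≤ x) → v ≤ minList xs
≤minList {v} (y ∷ ys) _ v≤ = glb ys (v≤ (here refl)) (v≤ ∘ there)
  where
  glb : ∀ zs → v ≤ y → (∀ {x} → x ∈ zs → v ≤ x) → v ≤ foldr _⊓_ y zs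
  glb []       v≤y _   = v≤y
  glb (z ∷ zs) v≤y v≤zs = ⊓-glb (v≤zs (here refl)) (glb zs v≤y (v≤zs ∘ there))

argmin∈ : ∀ (f : A → ℕ) x xs → argmin f x xs ∈ x ∷ xs
argmin∈ f x xs = argmin-all f (here refl) (All.tabulate there)

argmin≤ : ∀ (f : A → ℕ) x xs {z} → z ∈ x ∷ xs → f (argmin f x xs) ≤ f z
argmin≤ f x xs (here refl) = f[argmin]≤f[⊤] {f = f} x xs
argmin≤ f x xs (there z∈) = All.lookup (f[argmin]≤f[xs] {f = f} x xs) z∈

minimiser : ∀ (f : A → ℕ) {t xs} → t ∈ xs → ∃ λ m → m ∈ xs × (∀ {z} → z ∈ xs → f m ≤ f z)
minimiser f {t} {xs} t∈xs = argmin f t xs , ∈-absorb t∈xs (argmin∈ f t xs) , (λ z∈ → argmin≤ f t xs (there z∈))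

notFalse : ∀ {x} → (x ≡ false → ⊥) → x ≡ true
notFalse {true}  _ = refl
notFalse {false} h = ⊥-elim (h refl)

differ : ∀ {x y} → x ≡ false → y ≡ true → x ≢ y
differ refl refl ()

decisions-differ : ∀ {P Q : Set} (p? : Dec P) (q? : Dec Q) → does p? ≢ does q? → (P × ¬ Q) ⊎ (Q × ¬ P)
decisions-differ (yes p) (no ¬q)  _    = inj₁ (p , ¬q)
decisions-differ (no ¬p) (yes q)  _    = inj₂ (q , ¬p)
decisions-differ (yes _) (yes _)  diff = ⊥-elim (diff refl)
decisions-differ (no _)  (no _)   diff = ⊥-elim (diff refl)

sumOf : (A → ℕ) → List A → ℕ
sumOf f xs = sum (map f xs)

sumOf-++ : ∀ (f : A → ℕ) xs ys → sumOf f (xs ++ ys) ≡ sumOf f xs + sumOf f ys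
sumOf-++ f xs ys = trans (cong sum (map-++ f xs ys)) (sum-++ (map f xs) (map f ys))

sumOf-↭ : ∀ (f : A → ℕ) {xs ys} → xs ↭ ys → sumOf f xs ≡ sumOf f ys
sumOf-↭ f p = sum-↭ (Perm.map⁺ f p)

sumOf-map : ∀ (f : B → ℕ) (g : A → B) xs → sumOf f (map g xs) ≡ sumOf (f ∘ g) xs
sumOf-map f g xs = cong sum (sym (map-∘ xs))

sumOf-cong : ∀ (f g : A → ℕ) xs → (∀ {x} → x ∈ xs → f x ≡ g x) → sumOf f xs ≡ sumOf g xs
sumOf-cong f g [] _ = refl
sumOf-cong f g (x ∷ xs) e = cong₂ _+_ (e (here refl)) (sumOf-cong f g xs (e ∘ there))

sumOf-mono : ∀ (f g : A → ℕ) xs → (∀ {x} → x ∈ xs → f x ≤ g x) → sumOf f xs ≤ sumOf g xs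
sumOf-mono f g [] _ = z≤n
sumOf-mono f g (x ∷ xs) h = +-mono-≤ (h (here refl)) (sumOf-mono f g xs (h ∘ there))

sumOf-+ : ∀ (f g : A → ℕ) xs → sumOf (λ x → f x + g x) xs ≡ sumOf f xs + sumOf g xs
sumOf-+ f g [] = refl
sumOf-+ f g (x ∷ xs) = trans (cong (f x + g x +_) (sumOf-+ f g xs))
                             (+-+-comm (f x) (g x) (sumOf f xs) (sumOf g xs))
  where
  +-+-comm : ∀ a b c d → a + b + (c + d) ≡ a + c + (b + d)
  +-+-comm = solve-∀

sumOf-* : ∀ c (f : A → ℕ) xs → sumOf (λ x → c * f x) xs ≡ c * sumOf f xs
sumOf-* c f [] = sym (*-zeroʳ c)
sumOf-* c f (x ∷ xs) = trans (cong (c * f x +_) (sumOf-* c f xs)) (sym (*-distribˡ-+ c (f x) _))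

sumOf-const : ∀ c (xs : List A) → sumOf (λ _ → c) xs ≡ length xs * c
sumOf-const c [] = refl
sumOf-const c (_ ∷ xs) = cong (c +_) (sumOf-const c xs)

∈⇒≤sumOf : ∀ (f : A → ℕ) {xs x} → x ∈ xs → f x ≤ sumOf f xs
∈⇒≤sumOf f (here refl) = m≤m+n _ _
∈⇒≤sumOf f {y ∷ _} (there p) = ≤-trans (∈⇒≤sumOf f p) (m≤n+m _ (f y))

∣sumOf-sumOf∣≤ : ∀ (f g : A → ℕ) xs → ∣ sumOf f xs - sumOf g xs ∣ ≤ sumOf (λ x → ∣ f x - g x ∣) xs
∣sumOf-sumOf∣≤ f g [] = z≤n
∣sumOf-sumOf∣≤ f g (x ∷ xs) = begin
  ∣ f x + F - (g x + G) ∣       ≤⟨ ∣-∣-triangle (f x + F) (g x + F) (g x + G) ⟩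
  ∣ f x + F - (g x + F) ∣ + ∣ g x + F - (g x + G) ∣
    ≡⟨ cong₂ _+_ (trans (cong₂ ∣_-_∣ (+-comm (f x) F) (+-comm (g x) F)) (∣m+n-m+o∣≡∣n-o∣ F (f x) (g x)))
                 (∣m+n-m+o∣≡∣n-o∣ (g x) F G) ⟩
  ∣ f x - g x ∣ + ∣ F - G ∣      ≤⟨ +-monoʳ-≤ ∣ f x - g x ∣ (∣sumOf-sumOf∣≤ f g xs) ⟩
  ∣ f x - g x ∣ + sumOf (λ x → ∣ f x - g x ∣) xs ∎
  where
  open ≤-Reasoning
  F = sumOf f xs
  G = sumOf g xs

sumOf-⊆ : ∀ (f : A → ℕ) xs ys → Unique xs → (∀ {x} → x ∈ xs → x ∈ ys) → sumOf f xs ≤ sumOf f ys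
sumOf-⊆ f []       ys _                     _   = z≤n
sumOf-⊆ f (x ∷ xs) ys (x∉xs AllPairs.∷ uxs) xs⊆ys with ∈-∃++ (xs⊆ys (here refl))
... | us , vs , refl = begin
  f x + sumOf f xs          ≤⟨ +-monoʳ-≤ (f x) (sumOf-⊆ f xs (us ++ vs) uxs xs⊆us++vs) ⟩
  f x + sumOf f (us ++ vs)  ≡⟨ sym (sumOf-↭ f (Perm.shift x us vs)) ⟩
  sumOf f (us ++ x ∷ vs)    ∎
  where
  open ≤-Reasoning
  xs⊆us++vs : ∀ {z} → z ∈ xs → z ∈ us ++ vs
  xs⊆us++vs z∈xs = ∈-delete us vs (xs⊆ys (there z∈xs)) (λ z≡x → All.lookup x∉xs z∈xs (sym z≡x))

sumOf-swap : ∀ (h : A → B → ℕ) xs (ys : List B) →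
             sumOf (λ x → sumOf (h x) ys) xs ≡ sumOf (λ y → sumOf (λ x → h x y) xs) ys
sumOf-swap h []       ys = sym (trans (sumOf-const 0 ys) (*-zeroʳ (length ys)))
sumOf-swap h (x ∷ xs) ys = trans (cong (sumOf (h x) ys +_) (sumOf-swap h xs ys))
                                 (sym (sumOf-+ (h x) (λ y → sumOf (λ x → h x y) xs) ys))

indicator : Bool → ℕ
indicator true  = 1
indicator false = 0

count : (A → Bool) → List A → ℕ
count f = sumOf (λ x → indicator (f x))

length-filter≡count : ∀ {P : Pred A 0ℓ} (P? : Decidable P) xs →
                      length (filter P? xs) ≡ count (λ x → does (P? x)) xs
length-filter≡count P? [] = refl
length-filter≡count P? (x ∷ xs) with P? x
... | yes _ = cong suc (length-filter≡count P? xs)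
... | no  _ = length-filter≡count P? xs

count≤length : ∀ (f : A → Bool) xs → count f xs ≤ length xs
count≤length f xs = ≤-trans (sumOf-mono _ (λ _ → 1) xs (λ {x} _ → indicator≤1 (f x)))
                            (≤-reflexive (trans (sumOf-const 1 xs) (*-identityʳ _)))
  where
  indicator≤1 : ∀ b → indicator b ≤ 1
  indicator≤1 true  = ≤-refl
  indicator≤1 false = z≤n

count-true : ∀ (f : A → Bool) xs → (∀ {x} → x ∈ xs → f x ≡ true) → count f xs ≡ length xs
count-true f xs all = trans (sumOf-cong _ (λ _ → 1) xs (cong indicator ∘ all))
                            (trans (sumOf-const 1 xs) (*-identityʳ _))

count-false : ∀ (f : A → Bool) xs → (∀ {x} → x ∈ xs → f x ≡ false) → count f xs ≡ 0
count-false f xs none = trans (sumOf-cong _ (λ _ → 0) xs (cong indicator ∘ none))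
                              (trans (sumOf-const 0 xs) (*-zeroʳ (length xs)))

count-not : ∀ (f : A → Bool) xs → count (not ∘ f) xs + count f xs ≡ length xs
count-not f xs = trans (sym (sumOf-+ _ _ xs))
                       (trans (sumOf-cong _ (λ _ → 1) xs (λ {x} _ → not+id (f x)))
                              (trans (sumOf-const 1 xs) (*-identityʳ _)))
  where
  not+id : ∀ b → indicator (not b) + indicator b ≡ 1
  not+id true  = refl
  not+id false = refl

count-∧≤ : ∀ (f g : A → Bool) xs → count (λ x → f x ∧ g x) xs ≤ count g xs
count-∧≤ f g xs = sumOf-mono _ _ xs (λ {x} _ → ∧≤ (f x) (g x))
  where
  ∧≤ : ∀ a b → indicator (a ∧ b) ≤ indicator b
  ∧≤ true  b = ≤-refl
  ∧≤ false b = z≤n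

count-∧≡ : ∀ (f g : A → Bool) xs → (∀ {x} → x ∈ xs → g x ≡ true → f x ≡ true) →
           count (λ x → f x ∧ g x) xs ≡ count g xs
count-∧≡ f g xs g⇒f = sumOf-cong _ _ xs (λ {x} x∈ → ∧≡ (f x) (g x) (g⇒f x∈))
  where
  ∧≡ : ∀ a b → (b ≡ true → a ≡ true) → indicator (a ∧ b) ≡ indicator b
  ∧≡ true  b     _ = refl
  ∧≡ false true  h = ⊥-elim (differ refl refl (h refl))
  ∧≡ false false _ = refl

count-witness : ∀ (f : A → Bool) xs → count f xs ≡ 0 ⊎ ∃ λ x → x ∈ xs × f x ≡ true
count-witness f []       = inj₁ refl
count-witness f (x ∷ xs) with f x in fx | count-witness f xs
... | true  | _                   = inj₂ (x , here refl , fx)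
... | false | inj₁ none           = inj₁ none
... | false | inj₂ (y , y∈ , fy)  = inj₂ (y , there y∈ , fy)

module _ {C : Set} (_≟_ : DecidableEquality C) where
  open DecMembership _≟_ using (_∈?_)

  sumOf-≟-∈ : ∀ z X → Unique X → z ∈ X → sumOf (λ c → indicator (does (z ≟ c))) X ≡ 1
  sumOf-≟-∉ : ∀ z X → z ∉ X → sumOf (λ c → indicator (does (z ≟ c))) X ≡ 0
  sumOf-≟-∈ z (c ∷ X) (c∉X AllPairs.∷ _) (here refl) with z ≟ c
  ... | yes _   = cong suc (sumOf-≟-∉ z X (λ z∈X → All.lookup c∉X z∈X refl))
  ... | no  z≢z = ⊥-elim (z≢z refl)
  sumOf-≟-∈ z (c ∷ X) (c∉X AllPairs.∷ uX) (there z∈X) with z ≟ c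
  ... | yes refl = ⊥-elim (All.lookup c∉X z∈X refl)
  ... | no  _    = sumOf-≟-∈ z X uX z∈X
  sumOf-≟-∉ z []      _   = refl
  sumOf-≟-∉ z (c ∷ X) z∉ with z ≟ c
  ... | yes refl = ⊥-elim (z∉ (here refl))
  ... | no  _    = sumOf-≟-∉ z X (z∉ ∘ there)

  count-by-class : ∀ (h : A → C) (f : A → Bool) X ys → Unique X →
                   (∀ {y} → y ∈ ys → f y ≡ true → h y ∈ X) →
                   sumOf (λ c → count (λ y → f y ∧ does (h y ≟ c)) ys) X ≡ count f ys
  count-by-class h f X ys uX cover =
    trans (sumOf-swap (λ c y → indicator (f y ∧ does (h y ≟ c))) X ys)
          (sumOf-cong _ _ ys (λ {y} y∈ → classes (f y) (h y) (cover y∈)))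
    where
    classes : ∀ b z → (b ≡ true → z ∈ X) → sumOf (λ c → indicator (b ∧ does (z ≟ c))) X ≡ indicator b
    classes true  z z∈X = sumOf-≟-∈ z X uX (z∈X refl)
    classes false z _   = trans (sumOf-const 0 X) (*-zeroʳ (length X))

  count-∈?-++ : ∀ (h : A → C) Q P xs → Disjoint Q P →
                count (λ x → does (h x ∈? (Q ++ P))) xs ≡
                count (λ x → does (h x ∈? Q)) xs + count (λ x → does (h x ∈? P)) xs
  count-∈?-++ h Q P xs disj = trans (sumOf-cong _ _ xs (λ {x} _ → split (h x))) (sumOf-+ _ _ xs)
    where
    split : ∀ z → indicator (does (z ∈? (Q ++ P))) ≡ indicator (does (z ∈? Q)) + indicator (does (z ∈? P))
    split z with z ∈? Q | z ∈? P | z ∈? (Q ++ P)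
    ... | yes z∈Q | yes z∈P | _        = ⊥-elim (disj (z∈Q , z∈P))
    ... | yes z∈Q | no  _   | yes _    = refl
    ... | yes z∈Q | no  _   | no z∉Q++P = ⊥-elim (z∉Q++P (∈-++⁺ˡ z∈Q))
    ... | no  _   | yes z∈P | yes _    = refl
    ... | no  _   | yes z∈P | no z∉Q++P = ⊥-elim (z∉Q++P (∈-++⁺ʳ Q z∈P))
    ... | no  z∉Q | no  z∉P | yes z∈Q++P with ∈-++⁻ Q z∈Q++P
    ...   | inj₁ z∈Q = ⊥-elim (z∉Q z∈Q)
    ...   | inj₂ z∈P = ⊥-elim (z∉P z∈P)
    split z | no _ | no _ | no _ = refl

module _ {C : Set} (_≟_ : DecidableEquality C) (h : A → C) where
  open DecMembership _≟_ using (_∈?_)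

  classOf : List A → C → List A
  classOf X c = filter (λ x → h x ≟ c) X

  length-classOf : ∀ X c → length (classOf X c) ≡ count (λ x → does (h x ∈? [ c ])) X
  length-classOf X c = trans (length-filter≡count (λ x → h x ≟ c) X)
                             (sumOf-cong _ _ X (λ {x} _ → cong indicator (sym (Boolₚ.∨-identityʳ (does (h x ≟ c))))))

  distribute : ∀ cs X → Unique cs → All.All (λ x → h x ∈ cs) X → concatMap (classOf X) cs ↭ X
  distribute cs []      _  _ = ↭-reflexive (empty cs)
    where
    empty : ∀ cs → concatMap (classOf []) cs ≡ []
    empty []       = refl
    empty (_ ∷ cs) = empty cs
  distribute cs (x ∷ X) u (hx∈cs All.∷ covered) with ∈-∃++ hx∈cs
  ... | us , vs , refl = begin
    concatMap (classOf (x ∷ X)) (us ++ h x ∷ vs)                  ≡⟨ concatMap-++ (classOf (x ∷ X)) us (h x ∷ vs) ⟩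
    concatMap (classOf (x ∷ X)) us ++ classOf (x ∷ X) (h x) ++ concatMap (classOf (x ∷ X)) vs
      ≡⟨ cong₂ _++_ (others us (avoid ∘ ∈-++⁺ˡ))
                    (cong₂ _++_ (filter-accept (λ y → h y ≟ h x) refl) (others vs (avoid ∘ ∈-++⁺ʳ us))) ⟩
    concatMap (classOf X) us ++ (x ∷ classOf X (h x)) ++ concatMap (classOf X) vs  ↭⟨ Perm.shift x _ _ ⟩
    x ∷ concatMap (classOf X) us ++ classOf X (h x) ++ concatMap (classOf X) vs     ≡⟨ cong (x ∷_) (concatMap-++ (classOf X) us (h x ∷ vs)) ⟨
    x ∷ concatMap (classOf X) (us ++ h x ∷ vs)                                    ↭⟨ prep x (distribute (us ++ h x ∷ vs) X u covered) ⟩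
    x ∷ X ∎
    where
    open PermutationReasoning
    avoid : ∀ {c} → c ∈ us ++ vs → c ≢ h x
    avoid c∈ c≡hx with Unique-resp-↭ (Perm.shift (h x) us vs) u
    ... | hx∉ AllPairs.∷ _ = All.lookup hx∉ c∈ (sym c≡hx)
    others : ∀ ws → (∀ {c} → c ∈ ws → c ≢ h x) → concatMap (classOf (x ∷ X)) ws ≡ concatMap (classOf X) ws
    others []       _   = refl
    others (w ∷ ws) w≢ = cong₂ _++_ (filter-reject (λ y → h y ≟ w) (λ hx≡w → w≢ (here refl) (sym hx≡w))) (others ws (w≢ ∘ there))

dist-sym : ∀ p q → dist p q ≡ dist q p
dist-sym (a , b) (c , d) = cong₂ _+_ (∣-∣-comm a c) (∣-∣-comm b d)

dist-tri : ∀ p q r → dist p r ≤ dist p q + dist q r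
dist-tri (a , b) (c , d) (e , f) = begin
  ∣ a - e ∣ + ∣ b - f ∣                          ≤⟨ +-mono-≤ (∣-∣-triangle a c e) (∣-∣-triangle b d f) ⟩
  ∣ a - c ∣ + ∣ c - e ∣ + (∣ b - d ∣ + ∣ d - f ∣) ≡⟨ +-+-comm ∣ a - c ∣ ∣ c - e ∣ ∣ b - d ∣ ∣ d - f ∣ ⟩
  ∣ a - c ∣ + ∣ b - d ∣ + (∣ c - e ∣ + ∣ d - f ∣) ∎
  where
  open ≤-Reasoning
  +-+-comm : ∀ w x y z → w + x + (y + z) ≡ w + y + (x + z)
  +-+-comm = solve-∀

dist-self : ∀ p → dist p p ≡ 0
dist-self (a , b) = cong₂ _+_ (∣n-n∣≡0 a) (∣n-n∣≡0 b)

dist≡0⇒≡ : ∀ p q → dist p q ≡ 0 → p ≡ q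
dist≡0⇒≡ (a , b) (c , d) e =
  cong₂ _,_ (∣m-n∣≡0⇒m≡n (m+n≡0⇒m≡0 _ e)) (∣m-n∣≡0⇒m≡n (m+n≡0⇒n≡0 ∣ a - c ∣ e))

dist<2Δ : ∀ Δ p q → InBox Δ p → InBox Δ q → dist p q < 2 * Δ
dist<2Δ Δ (x , y) (x' , y') ((1≤x , x≤Δ) , (1≤y , y≤Δ)) ((1≤x' , x'≤Δ) , (1≤y' , y'≤Δ)) = begin-strict
  ∣ x - x' ∣ + ∣ y - y' ∣  <⟨ +-mono-<-≤ (coord x x' 1≤x x≤Δ 1≤x' x'≤Δ) (<⇒≤ (coord y y' 1≤y y≤Δ 1≤y' y'≤Δ)) ⟩
  Δ + Δ                   ≡⟨ cong (λ n → Δ + n) (sym (+-identityʳ Δ)) ⟩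
  2 * Δ                   ∎
  where
  open ≤-Reasoning
  coord : ∀ u v → 1 ≤ u → u ≤ Δ → 1 ≤ v → v ≤ Δ → ∣ u - v ∣ < Δ
  coord (suc u) (suc v) _ u<Δ _ v<Δ = ≤-<-trans (∣m-n∣≤m⊔n u v) (⊔-lub u<Δ v<Δ)

remainders-close : ∀ x y ra rb d → x + rb ≡ y + ra → ra < d → rb < d → ∣ x - y ∣ < d
remainders-close x y ra rb d eq ra<d rb<d = begin-strict
  ∣ x - y ∣                ≡⟨ sym (∣m+n-m+o∣≡∣n-o∣ rb x y) ⟩
  ∣ rb + x - rb + y ∣      ≡⟨ cong₂ ∣_-_∣ (trans (+-comm rb x) eq) (+-comm rb y) ⟩
  ∣ y + ra - y + rb ∣      ≡⟨ ∣m+n-m+o∣≡∣n-o∣ y ra rb ⟩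
  ∣ ra - rb ∣              ≤⟨ ∣m-n∣≤m⊔n ra rb ⟩
  ra ⊔ rb                  <⟨ ⊔-lub ra<d rb<d ⟩
  d                        ∎
  where open ≤-Reasoning

module _ where
  open ℤ using (ℤ; +_) renaming (_+_ to _+ℤ_; _-_ to _-ℤ_; -_ to -ℤ_; _*_ to _*ℤ_; ∣_∣ to ∣_∣ℤ)
  open ℤDivMod using (_/ℕ_; _%ℕ_; a≡a%ℕn+[a/ℕn]*n; n%ℕd<d; n<s[n/ℕd]*d)

  module _ (d : ℕ) .{{_ : NonZero d}} where

    /ℕ-lower : ∀ a → (a /ℕ d) *ℤ + d ℤ.≤ a
    /ℕ-lower a = ℤP.≤-trans (ℤP.i≤j+i _ (+ (a %ℕ d))) (ℤP.≤-reflexive (sym (a≡a%ℕn+[a/ℕn]*n a d)))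

    /ℕ-greatest : ∀ c a → c *ℤ + d ℤ.≤ a → c ℤ.≤ a /ℕ d
    /ℕ-greatest c a cd≤a = ℤP.≤-trans (ℤP.i<j⇒i≤pred[j] c<suc[q]) (ℤP.≤-reflexive (ℤP.pred-suc (a /ℕ d)))
      where
      c<suc[q] : c ℤ.< ℤ.suc (a /ℕ d)
      c<suc[q] = ℤP.*-cancelʳ-<-nonNeg (+ d) (ℤP.≤-<-trans cd≤a (n<s[n/ℕd]*d a d))

  cellIdx-close : ∀ i s x y → cellIdx i s x ≡ cellIdx i s y → ∣ x - y ∣ < 2 ^ i
  cellIdx-close i s x y same = remainders-close x y ra rb d (ℤP.+-injective shifted) (n%ℕd<d a d) (n%ℕd<d b d)
    where
    -- with a = x - s - 1 = ra + q·d and b = y - s - 1 = rb + q·d, x + rb = y + ra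
    d = 2 ^ i
    instance _ = m^n≢0 2 i
    a b : ℤ
    a = (+ x -ℤ s) -ℤ + 1
    b = (+ y -ℤ s) -ℤ + 1
    ra = a %ℕ d
    rb = b %ℕ d
    q = a /ℕ d
    a≡ : a ≡ + ra +ℤ q *ℤ + d
    a≡ = a≡a%ℕn+[a/ℕn]*n a d
    b≡ : b ≡ + rb +ℤ q *ℤ + d
    b≡ = trans (a≡a%ℕn+[a/ℕn]*n b d) (cong (λ c → + rb +ℤ c *ℤ + d) (sym same))
    unshift : ∀ X S R → X +ℤ R ≡ (((X -ℤ S) -ℤ + 1) +ℤ (S +ℤ + 1)) +ℤ R
    unshift = ℤ-Ring.solve-∀
    swap-rem : ∀ Ra Rb Q S → ((Ra +ℤ Q) +ℤ (S +ℤ + 1)) +ℤ Rb ≡ ((Rb +ℤ Q) +ℤ (S +ℤ + 1)) +ℤ Ra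
    swap-rem = ℤ-Ring.solve-∀
    shifted : + (x + rb) ≡ + (y + ra)
    shifted = begin
      + x +ℤ + rb                                   ≡⟨ unshift (+ x) s (+ rb) ⟩
      (a +ℤ (s +ℤ + 1)) +ℤ + rb                     ≡⟨ cong (λ c → (c +ℤ (s +ℤ + 1)) +ℤ + rb) a≡ ⟩
      ((+ ra +ℤ q *ℤ + d) +ℤ (s +ℤ + 1)) +ℤ + rb   ≡⟨ swap-rem (+ ra) (+ rb) (q *ℤ + d) s ⟩
      ((+ rb +ℤ q *ℤ + d) +ℤ (s +ℤ + 1)) +ℤ + ra   ≡⟨ cong (λ c → (c +ℤ (s +ℤ + 1)) +ℤ + ra) (sym b≡) ⟩
      (b +ℤ (s +ℤ + 1)) +ℤ + ra                     ≡⟨ sym (unshift (+ y) s (+ ra)) ⟩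
      + y +ℤ + ra                                   ∎
      where open ≡-Reasoning

  sameCell-close : ∀ i sh p q → cellOf i sh p ≡ cellOf i sh q → suc (dist p q) < 2 * 2 ^ i
  sameCell-close i (sx , sy) (x , y) (x' , y') same = begin-strict
    suc (∣ x - x' ∣ + ∣ y - y' ∣)  ≤⟨ ≤-reflexive (sym (+-suc ∣ x - x' ∣ ∣ y - y' ∣)) ⟩
    ∣ x - x' ∣ + suc ∣ y - y' ∣    <⟨ +-mono-<-≤ (cellIdx-close i sx x x' (cong proj₁ same))
                                                 (cellIdx-close i sy y y' (cong proj₂ same)) ⟩
    2 ^ i + 2 ^ i                 ≡⟨ cong (λ n → 2 ^ i + n) (sym (+-identityʳ (2 ^ i))) ⟩
    2 * 2 ^ i                     ∎
    where open ≤-Reasoning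

  ∈-interval : ∀ lo hi m → lo ℤ.≤ m → m ℤ.≤ hi → m ∈ map (λ t → lo +ℤ + t) (upTo (suc ∣ hi -ℤ lo ∣ℤ))
  ∈-interval lo hi m lo≤m m≤hi = subst (_∈ _) lo+t≡m (∈-map⁺ (λ t → lo +ℤ + t) (∈-upTo⁺ (s≤s t≤)))
    where
    t = ∣ m -ℤ lo ∣ℤ
    +t≡m-lo : + t ≡ m -ℤ lo
    +t≡m-lo = ℤP.0≤i⇒+∣i∣≡i (ℤP.i≤j⇒0≤j-i lo≤m)
    lo+t≡m : lo +ℤ + t ≡ m
    lo+t≡m = trans (cong (lo +ℤ_) +t≡m-lo) (cancel lo m)
      where
      cancel : ∀ L M → L +ℤ (M -ℤ L) ≡ M
      cancel = ℤ-Ring.solve-∀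
    t≤ : t ≤ ∣ hi -ℤ lo ∣ℤ
    t≤ = ℤP.drop‿+≤+ (begin
      + t           ≡⟨ +t≡m-lo ⟩
      m -ℤ lo       ≤⟨ ℤP.+-monoˡ-≤ (-ℤ lo) m≤hi ⟩
      hi -ℤ lo      ≡⟨ sym (ℤP.0≤i⇒+∣i∣≡i (ℤP.i≤j⇒0≤j-i (ℤP.≤-trans lo≤m m≤hi))) ⟩
      + ∣ hi -ℤ lo ∣ℤ ∎)
      where open ℤP.≤-Reasoning

  cellIdx∈axisRange : ∀ Δ i s x → 1 ≤ x → x ≤ Δ → cellIdx i s x ∈ axisRange Δ i s
  cellIdx∈axisRange Δ i s (suc x) _ 1+x≤Δ = ∈-interval lo hi m lo≤m m≤hi
    where
    d = 2 ^ i
    instance _ = m^n≢0 2 i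
    a = (+ suc x -ℤ s) -ℤ + 1
    lo hi m : ℤ
    lo = -ℤ (s /ℕ d) -ℤ + 1
    hi = ((+ Δ -ℤ + 1) -ℤ s) /ℕ d
    m  = a /ℕ d
    -- write s = rs + qs·d with rs < d, and d = 1 + rs + e
    rs = s %ℕ d
    qs = s /ℕ d
    e  = proj₁ (m≤n⇒∃[o]m+o≡n (n%ℕd<d s d))
    d≡ : suc rs + e ≡ d
    d≡ = proj₂ (m≤n⇒∃[o]m+o≡n (n%ℕd<d s d))
    s≡ : s ≡ + rs +ℤ qs *ℤ + (suc rs + e)
    s≡ = trans (a≡a%ℕn+[a/ℕn]*n s d) (cong (λ n → + rs +ℤ qs *ℤ + n) (sym d≡))
    regroup : ∀ X R E Q → ((+ 1 +ℤ X) -ℤ (R +ℤ Q *ℤ (+ 1 +ℤ R +ℤ E))) -ℤ + 1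
                          ≡ (-ℤ Q -ℤ + 1) *ℤ (+ 1 +ℤ R +ℤ E) +ℤ (X +ℤ (+ 1 +ℤ E))
    regroup = ℤ-Ring.solve-∀
    a≡ : a ≡ lo *ℤ + d +ℤ + (x + suc e)
    a≡ = begin
      a                                                 ≡⟨ cong (λ c → (+ suc x -ℤ c) -ℤ + 1) s≡ ⟩
      (+ suc x -ℤ (+ rs +ℤ qs *ℤ + (suc rs + e))) -ℤ + 1 ≡⟨ regroup (+ x) (+ rs) (+ e) qs ⟩
      lo *ℤ + (suc rs + e) +ℤ + (x + suc e)              ≡⟨ cong (λ n → lo *ℤ + n +ℤ + (x + suc e)) d≡ ⟩
      lo *ℤ + d +ℤ + (x + suc e)                          ∎
      where open ≡-Reasoning
    lo≤m : lo ℤ.≤ m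
    lo≤m = /ℕ-greatest d lo a (ℤP.≤-trans (ℤP.i≤i+j (lo *ℤ + d) (+ (x + suc e))) (ℤP.≤-reflexive (sym a≡)))
    a≤ : a ℤ.≤ (+ Δ -ℤ + 1) -ℤ s
    a≤ = ℤP.≤-trans (ℤP.≤-reflexive (reorder (+ suc x) s))
                   (ℤP.+-monoˡ-≤ (-ℤ s) (ℤP.+-monoˡ-≤ (-ℤ + 1) (ℤ.+≤+ 1+x≤Δ)))
      where
      reorder : ∀ X S → (X -ℤ S) -ℤ + 1 ≡ (X -ℤ + 1) -ℤ S
      reorder = ℤ-Ring.solve-∀
    m≤hi : m ℤ.≤ hi
    m≤hi = /ℕ-greatest d m _ (ℤP.≤-trans (/ℕ-lower d a) a≤)

  cellOf∈gridCells : ∀ Δ i sh p → InBox Δ p → cellOf i sh p ∈ gridCells Δ i sh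
  cellOf∈gridCells Δ i (sx , sy) (x , y) ((1≤x , x≤Δ) , (1≤y , y≤Δ)) =
    ∈-concatMap⁺ (λ mx → map (mx ,_) (axisRange Δ i sy))
                 (Any.map (λ { refl → ∈-map⁺ (cellIdx i sx x ,_) (cellIdx∈axisRange Δ i sy y 1≤y y≤Δ) })
                          (cellIdx∈axisRange Δ i sx x 1≤x x≤Δ))

-- The separation lemma

-- If the points of A and of B are coloured red/blue (true/false) so that
-- differently coloured pairs in A×A and A×B are at distance ≥ 2·2^i - 1, then
-- every grid of cell size 2^i sees the imbalance of the red points: a cell with
-- a red point has only red points of A, and only red points of B if it has a
-- point of A at all.
separation : ∀ Δ i sh (A B : List Point) → All (InBox Δ) A → All (InBox Δ) B →
             (colA colB : Point → Bool) →
             (∀ {a a'} → a ∈ A → a' ∈ A → colA a ≢ colA a' → 2 * 2 ^ i ≤ suc (dist a a')) →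
             (∀ {a b}  → a ∈ A → b ∈ B → colA a ≢ colB b  → 2 * 2 ^ i ≤ suc (dist a b)) →
             ∣ count colA A - count colB B ∣ ≤ gridDiff Δ i sh A B
separation Δ i sh A B boxA boxB colA colB sepAA sepAB = begin
  ∣ count colA A - count colB B ∣
    ≡⟨ sym (cong₂ ∣_-_∣ (count-by-class _≟C_ cell colA X A uX coverA) (count-by-class _≟C_ cell colB X B uX coverB)) ⟩
  ∣ sumOf (redIn colA A) X - sumOf (redIn colB B) X ∣
    ≤⟨ ∣sumOf-sumOf∣≤ (redIn colA A) (redIn colB B) X ⟩
  sumOf (λ c → ∣ redIn colA A c - redIn colB B c ∣) X
    ≤⟨ sumOf-mono _ _ X perCell ⟩
  sumOf diff X
    ≤⟨ sumOf-⊆ diff X (gridCells Δ i sh) uX X⊆grid ⟩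
  sumOf diff (gridCells Δ i sh)
    ≡⟨ sumOf-cong _ _ (gridCells Δ i sh) (λ {c} _ → cong₂ ∣_-_∣ (length-filter≡count _ A) (length-filter≡count _ B)) ⟨
  gridDiff Δ i sh A B ∎
  where
  open ≤-Reasoning
  cell : Point → Cell
  cell = cellOf i sh

  inCell : Cell → Point → Bool
  inCell c p = does (cell p ≟C c)

  redIn : (Point → Bool) → List Point → Cell → ℕ
  redIn col S c = count (λ p → col p ∧ inCell c p) S

  diff : Cell → ℕ
  diff c = ∣ count (inCell c) A - count (inCell c) B ∣

  redPts : List Point
  redPts = filter (λ p → colA p Boolₚ.≟ true) A ++ filter (λ p → colB p Boolₚ.≟ true) B

  X : List Cell
  X = deduplicate _≟C_ (map cell redPts)

  uX : Unique X
  uX = deduplicate-! _≟C_ (map cell redPts)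

  coverA : ∀ {a} → a ∈ A → colA a ≡ true → cell a ∈ X
  coverA a∈ red = ∈-deduplicate⁺ _≟C_ (∈-map⁺ cell (∈-++⁺ˡ (∈-filter⁺ _ a∈ red)))
  coverB : ∀ {b} → b ∈ B → colB b ≡ true → cell b ∈ X
  coverB b∈ red = ∈-deduplicate⁺ _≟C_ (∈-map⁺ cell (∈-++⁺ʳ _ (∈-filter⁺ _ b∈ red)))

  witness : ∀ {c} → c ∈ X → ∃ λ r → ((r ∈ A × colA r ≡ true) ⊎ (r ∈ B × colB r ≡ true)) × cell r ≡ c
  witness c∈X with ∈-map⁻ cell (∈-deduplicate⁻ _≟C_ (map cell redPts) c∈X)
  ... | r , r∈ , refl with ∈-++⁻ _ r∈
  ... | inj₁ r∈A = r , inj₁ (∈-filter⁻ _ r∈A) , refl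
  ... | inj₂ r∈B = r , inj₂ (∈-filter⁻ _ r∈B) , refl

  X⊆grid : ∀ {c} → c ∈ X → c ∈ gridCells Δ i sh
  X⊆grid c∈X with witness c∈X
  ... | r , inj₁ (r∈A , _) , refl = cellOf∈gridCells Δ i sh r (All.lookup boxA r∈A)
  ... | r , inj₂ (r∈B , _) , refl = cellOf∈gridCells Δ i sh r (All.lookup boxB r∈B)

  unseparated : ∀ {p q} → cell p ≡ cell q → 2 * 2 ^ i ≤ suc (dist p q) → ⊥
  unseparated same far = <⇒≱ (sameCell-close i sh _ _ same) far

  inCell⇒≡ : ∀ {c p} → inCell c p ≡ true → cell p ≡ c
  inCell⇒≡ {c} {p} _ with cell p ≟C c
  inCell⇒≡ _  | yes same = same
  inCell⇒≡ () | no _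

  allRedA : ∀ {c} → c ∈ X → ∀ {a} → a ∈ A → inCell c a ≡ true → colA a ≡ true
  allRedA c∈X a∈ a∈c with witness c∈X
  ... | r , inj₁ (r∈A , red) , refl = notFalse (λ blue → unseparated (inCell⇒≡ a∈c) (sepAA a∈ r∈A (differ blue red)))
  ... | r , inj₂ (r∈B , red) , refl = notFalse (λ blue → unseparated (inCell⇒≡ a∈c) (sepAB a∈ r∈B (differ blue red)))

  allRedB : ∀ {c a} → a ∈ A → colA a ≡ true → inCell c a ≡ true → ∀ {b} → b ∈ B → inCell c b ≡ true → colB b ≡ true
  allRedB a∈ red a∈c b∈ b∈c =
    notFalse (λ blue → unseparated (trans (inCell⇒≡ a∈c) (sym (inCell⇒≡ b∈c))) (sepAB a∈ b∈ (λ eq → differ blue red (sym eq))))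

  -- in each cell of X the red imbalance is at most the imbalance: if the cell
  -- has a point of A all its points are red, and otherwise A contributes nothing
  perCell : ∀ {c} → c ∈ X → ∣ redIn colA A c - redIn colB B c ∣ ≤ diff c
  perCell {c} c∈X with count-witness (inCell c) A
  ... | inj₂ (a , a∈ , a∈c) =
    ≤-reflexive (cong₂ ∣_-_∣ (count-∧≡ colA (inCell c) A (allRedA c∈X))
                              (count-∧≡ colB (inCell c) B (allRedB a∈ (allRedA c∈X a∈ a∈c) a∈c)))
  ... | inj₁ emptyA = begin
    ∣ redIn colA A c - redIn colB B c ∣ ≡⟨ cong (λ n → ∣ n - redIn colB B c ∣)
                                                 (n≤0⇒n≡0 (≤-trans (count-∧≤ colA (inCell c) A) (≤-reflexive emptyA))) ⟩
    ∣ 0 - redIn colB B c ∣              ≤⟨ count-∧≤ colB (inCell c) B ⟩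
    count (inCell c) B                 ≡⟨ cong (λ n → ∣ n - count (inCell c) B ∣) emptyA ⟨
    diff c                             ∎

Matching : Set
Matching = List (Point × Point)

cost : Matching → ℕ
cost = sumOf (λ (a , b) → dist a b)

cost-swap : ∀ (M : Matching) → cost (map Product.swap M) ≡ cost M
cost-swap []            = refl
cost-swap ((a , b) ∷ M) = cong₂ _+_ (dist-sym b a) (cost-swap M)

EMD≤cost : ∀ S T (M : Matching) → map proj₁ M ↭ S → map proj₂ M ↭ T → EMD S T ≤ cost M
EMD≤cost S T M M₁↭S M₂↭T with Perm.↭-map-inv proj₁ M₁↭S
... | M' , refl , M↭M' = begin
  EMD (map proj₁ M') T                      ≤⟨ minList≤ (∈-map⁺ (matchCost (map proj₁ M')) (perms-complete T (map proj₂ M') M'₂↭T)) ⟩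
  matchCost (map proj₁ M') (map proj₂ M')   ≡⟨ zipWith-cost M' ⟩
  cost M'                                   ≡⟨ sumOf-↭ _ M↭M' ⟨
  cost M                                    ∎
  where
  open ≤-Reasoning
  M'₂↭T : map proj₂ M' ↭ T
  M'₂↭T = ↭-trans (Perm.map⁺ proj₂ (↭-sym M↭M')) M₂↭T
  zipWith-cost : ∀ (P : Matching) → matchCost (map proj₁ P) (map proj₂ P) ≡ cost P
  zipWith-cost []            = refl
  zipWith-cost ((a , b) ∷ P) = cong (dist a b +_) (zipWith-cost P)

EMD≤cost-swapped : ∀ S T (M : Matching) → map proj₁ M ↭ T → map proj₂ M ↭ S → EMD S T ≤ cost M
EMD≤cost-swapped S T M M₁↭T M₂↭S =
  subst (EMD S T ≤_) (cost-swap M)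
        (EMD≤cost S T (map Product.swap M) (↭-trans (↭-reflexive (sym (map-∘ M))) M₂↭S) (↭-trans (↭-reflexive (sym (map-∘ M))) M₁↭T))

-- This is all the proof uses
-- about the estimator twoY.
record GridBound (L : ℕ) (A B : List Point) (Y : ℕ) : Set where
  field
    level : ∀ i x → i ≤ L → (∀ sh → x ≤ gridDiff (2 ^ L) i sh A B) → 2 ^ i * x ≤ Y
    total : ∀ (x : ℕ → ℕ) → (∀ i → i ≤ L → ∀ sh → x i ≤ gridDiff (2 ^ L) i sh A B) →
            sumOf (λ i → 2 ^ i * x i) (upTo (suc L)) ≤ Y

gridDiff-sym : ∀ Δ i sh S T → gridDiff Δ i sh S T ≡ gridDiff Δ i sh T S
gridDiff-sym Δ i sh S T =
  sumOf-cong _ _ (gridCells Δ i sh) (λ {c} _ → ∣-∣-comm (cellCount i sh S c) (cellCount i sh T c))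

GridBound-swap : ∀ {L A B Y} → GridBound L A B Y → GridBound L B A Y
GridBound-swap {L} {A} {B} bound = record
  { level = λ i x i≤L lb → level i x i≤L (λ sh → ≤-trans (lb sh) (flip i sh))
  ; total = λ x lb → total x (λ i i≤L sh → ≤-trans (lb i i≤L sh) (flip i sh))
  }
  where
  open GridBound bound
  flip : ∀ i sh → gridDiff (2 ^ L) i sh B A ≤ gridDiff (2 ^ L) i sh A B
  flip i sh = ≤-reflexive (gridDiff-sym (2 ^ L) i sh B A)

-- with at least one shift per level (L ≥ 1), the estimator 2Y of the paper is a grid bound
twoY-bound : ∀ L shift S T → GridBound (suc L) S T (twoY (suc L) shift S T)
twoY-bound L shift S T = record
  { level = λ i x i≤L lb → ≤-trans (*-monoʳ-≤ (2 ^ i) (≤Cmin i x lb))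
                                   (∈⇒≤sumOf (λ i → 2 ^ i * Cmin (suc L) shift S T i) (∈-upTo⁺ (s≤s i≤L)))
  ; total = λ x lb → sumOf-mono _ _ (upTo (suc (suc L)))
                       (λ {i} i∈ → *-monoʳ-≤ (2 ^ i) (≤Cmin i (x i) (lb i (s≤s⁻¹ (∈-upTo⁻ i∈)))))
  }
  where
  ≤Cmin : ∀ i x → (∀ sh → x ≤ gridDiff (2 ^ suc L) i sh S T) → x ≤ Cmin (suc L) shift S T i
  ≤Cmin i x lb = ≤minList (map grid (upTo (2 * suc L))) (s≤s z≤n)
                          (λ c∈ → let j , _ , c≡ = ∈-map⁻ grid c∈ in subst (x ≤_) (sym c≡) (lb (shift i (suc j))))
    where
    grid : ℕ → ℕ
    grid j = gridDiff (2 ^ suc L) i (shift i (suc j)) S T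

-- Dyadic scales

dyadicWeight : ℕ → ℕ → ℕ
dyadicWeight M r = sumOf (λ i → 2 ^ i * indicator (does (2 * 2 ^ i ≤? r))) (upTo (suc M))

dyadicWeight-suc : ∀ M r → dyadicWeight (suc M) r ≡ dyadicWeight M r + 2 ^ suc M * indicator (does (2 * 2 ^ suc M ≤? r))
dyadicWeight-suc M r = begin
  dyadicWeight (suc M) r                         ≡⟨ cong (sumOf term) (upTo-∷ʳ (suc M)) ⟨
  sumOf term (upTo (suc M) ∷ʳ suc M)             ≡⟨ sumOf-++ term (upTo (suc M)) (suc M ∷ []) ⟩
  dyadicWeight M r + (term (suc M) + 0)          ≡⟨ cong (dyadicWeight M r +_) (+-identityʳ _) ⟩
  dyadicWeight M r + term (suc M)                ∎
  where
  open ≡-Reasoning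
  term : ℕ → ℕ
  term i = 2 ^ i * indicator (does (2 * 2 ^ i ≤? r))

dyadicWeight-full : ∀ M r → 2 * 2 ^ M ≤ r → dyadicWeight M r + 1 ≡ 2 * 2 ^ M
dyadicWeight-full zero r 2≤r rewrite dec-true (2 ≤? r) 2≤r = refl
dyadicWeight-full (suc M) r big = begin
  dyadicWeight (suc M) r + 1                        ≡⟨ cong (_+ 1) (dyadicWeight-suc M r) ⟩
  dyadicWeight M r + 2 ^ suc M * indicator (does (2 * 2 ^ suc M ≤? r)) + 1
                                                    ≡⟨ cong (λ b → dyadicWeight M r + 2 ^ suc M * indicator b + 1) (dec-true (_ ≤? r) big) ⟩
  dyadicWeight M r + 2 ^ suc M * 1 + 1              ≡⟨ regroup (dyadicWeight M r) (2 ^ suc M) ⟩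
  (dyadicWeight M r + 1) + 2 ^ suc M                ≡⟨ cong (_+ 2 ^ suc M) (dyadicWeight-full M r (≤-trans (*-monoʳ-≤ 2 (m≤m+n (2 ^ M) _)) big)) ⟩
  2 * 2 ^ M + 2 ^ suc M                             ≡⟨ double (2 ^ M) ⟩
  2 * 2 ^ suc M                                     ∎
  where
  open ≡-Reasoning
  regroup : ∀ a b → a + b * 1 + 1 ≡ (a + 1) + b
  regroup = solve-∀
  double : ∀ a → 2 * a + 2 * a ≡ 2 * (2 * a)
  double = solve-∀

weight-mono : ∀ M r → 2 * dyadicWeight M r + 1 ≤ 2 * dyadicWeight (suc M) r + 1
weight-mono M r = +-monoˡ-≤ 1 (*-monoʳ-≤ 2 (≤-trans (m≤m+n (dyadicWeight M r) _) (≤-reflexive (sym (dyadicWeight-suc M r)))))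

≤dyadicWeight : ∀ M r → r < 2 * 2 ^ M → r ≤ 2 * dyadicWeight M r + 1
≤dyadicWeight zero r (s≤s r≤1) = ≤-trans r≤1 (m≤n+m 1 _)
≤dyadicWeight (suc M) r r< with r <? 2 * 2 ^ M
... | yes small = ≤-trans (≤dyadicWeight M r small) (weight-mono M r)
... | no large = ≤-trans (s≤s⁻¹ r<suc) (weight-mono M r)
  where
  shape : ∀ a → 2 * (a + 1) ≡ suc (2 * a + 1)
  shape = solve-∀
  r<suc : r < suc (2 * dyadicWeight M r + 1)
  r<suc = begin-strict
    r                                 <⟨ r< ⟩
    2 * (2 * 2 ^ M)                   ≡⟨ cong (2 *_) (dyadicWeight-full M r (≮⇒≥ large)) ⟨
    2 * (dyadicWeight M r + 1)        ≡⟨ shape (dyadicWeight M r) ⟩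
    suc (2 * dyadicWeight M r + 1)    ∎
    where open ≤-Reasoning

-- layer-cake bound: values below 2·2^M sum to at most twice the dyadically
-- weighted numbers of values above each threshold 2·2^i, plus one per value
layerCake : ∀ M (r : A → ℕ) xs → (∀ {x} → x ∈ xs → r x < 2 * 2 ^ M) →
            sumOf r xs ≤ 2 * sumOf (λ i → 2 ^ i * count (λ x → does (2 * 2 ^ i ≤? r x)) xs) (upTo (suc M)) + length xs
layerCake M r xs small = begin
  sumOf r xs                                                        ≤⟨ sumOf-mono r _ xs (λ x∈ → ≤dyadicWeight M _ (small x∈)) ⟩
  sumOf (λ x → 2 * dyadicWeight M (r x) + 1) xs                     ≡⟨ sumOf-+ _ (λ _ → 1) xs ⟩
  sumOf (λ x → 2 * dyadicWeight M (r x)) xs + sumOf (λ _ → 1) xs    ≡⟨ cong₂ _+_ (sumOf-* 2 _ xs) (trans (sumOf-const 1 xs) (*-identityʳ _)) ⟩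
  2 * sumOf (λ x → dyadicWeight M (r x)) xs + length xs             ≡⟨ cong (λ n → 2 * n + length xs) exchange ⟩
  2 * sumOf (λ i → 2 ^ i * count (λ x → does (2 * 2 ^ i ≤? r x)) xs) (upTo (suc M)) + length xs ∎
  where
  open ≤-Reasoning
  exchange : sumOf (λ x → dyadicWeight M (r x)) xs ≡ sumOf (λ i → 2 ^ i * count (λ x → does (2 * 2 ^ i ≤? r x)) xs) (upTo (suc M))
  exchange = trans (sumOf-swap (λ x i → 2 ^ i * indicator (does (2 * 2 ^ i ≤? r x))) xs (upTo (suc M)))
                   (sumOf-cong _ _ (upTo (suc M)) (λ {i} _ → sumOf-* (2 ^ i) _ xs))

dyadicScale : ∀ M δ → 4 ≤ δ → δ < 8 * 2 ^ M → ∃ λ j → j ≤ M × 4 * 2 ^ j ≤ δ × δ < 8 * 2 ^ j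
dyadicScale zero    δ 4≤δ δ< = 0 , z≤n , 4≤δ , δ<
dyadicScale (suc M) δ 4≤δ δ< with δ <? 8 * 2 ^ M
... | yes below = let j , j≤M , lower , upper = dyadicScale M δ 4≤δ below in j , m≤n⇒m≤1+n j≤M , lower , upper
... | no above  = suc M , ≤-refl , ≤-trans (≤-reflexive (regroup (2 ^ M))) (≮⇒≥ above) , δ<
  where
  regroup : ∀ a → 4 * (2 * a) ≡ 8 * a
  regroup = solve-∀

-- if d ≤ Y and 2^j·d ≤ Y at every level j ≤ L with 4·2^j ≤ δ, then d·δ ≤ 8Y,
-- for every δ < 2·2^L: a δ ≥ 4 has such a level j with δ < 8·2^j
scale-bound : ∀ L Y d δ → δ < 2 * 2 ^ L → d ≤ Y →
              (∀ j → j ≤ L → 4 * 2 ^ j ≤ δ → 2 ^ j * d ≤ Y) → d * δ ≤ 8 * Y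
scale-bound L Y d δ δ< d≤Y atLevel with δ <? 4
... | yes δ<4 = begin
  d * δ    ≤⟨ *-mono-≤ d≤Y (s≤s⁻¹ δ<4) ⟩
  Y * 3    ≤⟨ *-monoʳ-≤ Y 3≤8 ⟩
  Y * 8    ≡⟨ *-comm Y 8 ⟩
  8 * Y    ∎
  where
  open ≤-Reasoning
  3≤8 : 3 ≤ 8
  3≤8 = s≤s (s≤s (s≤s z≤n))
... | no δ≮4 = let j , j≤L , lower , upper = dyadicScale L δ (≮⇒≥ δ≮4) (≤-trans δ< (*-monoˡ-≤ (2 ^ L) 2≤8)) in begin
  d * δ              ≤⟨ *-monoʳ-≤ d (<⇒≤ upper) ⟩
  d * (8 * 2 ^ j)    ≡⟨ regroup d (2 ^ j) ⟩
  8 * (2 ^ j * d)    ≤⟨ *-monoʳ-≤ 8 (atLevel j j≤L lower) ⟩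
  8 * Y              ∎
  where
  open ≤-Reasoning
  2≤8 : 2 ≤ 8
  2≤8 = s≤s (s≤s z≤n)
  regroup : ∀ a b → a * (8 * b) ≡ 8 * (b * a)
  regroup = solve-∀

one-sided-size : ∀ a b c d → a ≡ 0 ⊎ b ≡ 0 → a + c ≡ b + d → a + b ≡ ∣ d - c ∣
one-sided-size .0 b c d (inj₁ refl) c≡b+d = sym (trans (cong ∣ d -_∣ (trans c≡b+d (+-comm b d))) (∣m-m+n∣≡n d b))
one-sided-size a .0 c d (inj₂ refl) a+c≡d = trans (+-identityʳ a)
  (sym (trans (cong ∣_- c ∣ (trans (sym a+c≡d) (+-comm a c))) (trans (∣-∣-comm (c + a) c) (∣m-m+n∣≡n c a))))

merge-balance : ∀ m ex ey aQ aP bQ bP cQ cP dQ dP → m + ex ≡ aQ + aP → m + ey ≡ bQ + bP →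
                aQ + cQ ≡ bQ + dQ → aP + cP ≡ bP + dP → ex + (cQ + cP) ≡ ey + (dQ + dP)
merge-balance m ex ey aQ aP bQ bP cQ cP dQ dP splitA splitB balQ balP = +-cancelˡ-≡ m _ _ (begin
  m + (ex + (cQ + cP))        ≡⟨ +-assoc m ex _ ⟨
  (m + ex) + (cQ + cP)        ≡⟨ cong (_+ (cQ + cP)) splitA ⟩
  (aQ + aP) + (cQ + cP)       ≡⟨ exchange aQ aP cQ cP ⟩
  (aQ + cQ) + (aP + cP)       ≡⟨ cong₂ _+_ balQ balP ⟩
  (bQ + dQ) + (bP + dP)       ≡⟨ exchange bQ dQ bP dP ⟩
  (bQ + bP) + (dQ + dP)       ≡⟨ cong (_+ (dQ + dP)) splitB ⟨
  (m + ey) + (dQ + dP)        ≡⟨ +-assoc m ey _ ⟩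
  m + (ey + (dQ + dP))        ∎)
  where
  open ≡-Reasoning
  exchange : ∀ w x y z → (w + x) + (y + z) ≡ (w + y) + (x + z)
  exchange = solve-∀

merge-diameter : ∀ a b δ → 1 ≤ a → 1 ≤ b → (a ∸ 1) * δ + (δ + (b ∸ 1) * δ) ≡ (a + b ∸ 1) * δ
merge-diameter (suc a) (suc b) δ _ _ = trans (expand a b δ) (cong (_* δ) (sym (+-suc a b)))
  where
  expand : ∀ a b δ → a * δ + (δ + b * δ) ≡ suc (a + b) * δ
  expand = solve-∀

-- the budget after a merge: paying cp ≤ sp + K for the new pairs uses up one allowance K
merge-budget : ∀ cM cp sp sr sR K r Z → cp ≤ sp + K → cM + ((sp + sr) + sR) + suc (suc r) * K ≤ Z →
               cM + cp + (sr + sR) + suc r * K ≤ Z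
merge-budget cM cp sp sr sR K r Z cp≤ budget = begin
  cM + cp + (sr + sR) + suc r * K          ≤⟨ +-monoˡ-≤ (suc r * K) (+-monoˡ-≤ (sr + sR) (+-monoʳ-≤ cM cp≤)) ⟩
  cM + (sp + K) + (sr + sR) + suc r * K    ≡⟨ regroup cM sp sr sR K r ⟩
  cM + ((sp + sr) + sR) + suc (suc r) * K  ≤⟨ budget ⟩
  Z                                        ∎
  where
  open ≤-Reasoning
  regroup : ∀ cM sp sr sR K r → cM + (sp + K) + (sr + sR) + suc r * K ≡ cM + ((sp + sr) + sR) + suc (suc r) * K
  regroup = solve-∀

-- the final accounting: with allowance K = (k - 1)·8Y per merge and transport cost
-- r ≤ 3Y, a matching within budget costs at most 11·k²·Y
final-cost : ∀ k Y c r → 1 ≤ k → c + (k ∸ 1) * (8 * Y) ≤ r + k * ((k ∸ 1) * (8 * Y)) → r ≤ 3 * Y →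
             c ≤ 11 * k ^ 2 * Y
final-cost (suc k) Y c r _ budget r≤3Y = begin
  c                             ≤⟨ +-cancelʳ-≤ K c (r + k * K) (≤-trans budget (≤-reflexive (shift r K (k * K)))) ⟩
  r + k * K                     ≤⟨ +-monoˡ-≤ (k * K) r≤3Y ⟩
  3 * Y + k * (k * (8 * Y))     ≤⟨ m≤m+n _ (8 * Y + 22 * k * Y + 3 * k * k * Y) ⟩
  3 * Y + k * (k * (8 * Y)) + (8 * Y + 22 * k * Y + 3 * k * k * Y) ≡⟨ expand k Y ⟩
  11 * suc k ^ 2 * Y            ∎
  where
  open ≤-Reasoning
  K = k * (8 * Y)
  shift : ∀ r K L → r + (K + L) ≡ r + L + K
  shift = solve-∀
  expand : ∀ k Y → 3 * Y + k * (k * (8 * Y)) + (8 * Y + 22 * k * Y + 3 * k * k * Y) ≡ 11 * ((1 + k) * ((1 + k) * 1)) * Y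
  expand = solve-∀

-- The clustering

open DecMembership _≟P_ using (_∈?_)

-- Candidate merges of a family of clusters: the triples of a cluster C, one of
-- its members x, and a site z outside it.
module _ {X : Set} (members : X → List Point) (zs : List Point) where

  outside : X → List Point
  outside C = filter (λ z → ¬? (z ∈? members C)) zs

  triples : List X → List (X × Point × Point)
  triples = concatMap (λ C → concatMap (λ x → map (λ z → (C , x , z)) (outside C)) (members C))

  ∈-triples⁺ : ∀ Cs {C x z} → C ∈ Cs → x ∈ members C → z ∈ zs → z ∉ members C → (C , x , z) ∈ triples Cs
  ∈-triples⁺ Cs {C} {x} C∈ x∈ z∈ z∉ =
    ∈-concatMap⁺ _ (Any.map (λ { refl → ∈-concatMap⁺ _ (Any.map (λ { refl → ∈-map⁺ (λ z → (C , x , z)) (∈-filter⁺ _ z∈ z∉) })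
                                                                 x∈) })
                            C∈)

  ∈-triples⁻ : ∀ Cs {C x z} → (C , x , z) ∈ triples Cs → C ∈ Cs × x ∈ members C × z ∈ zs × z ∉ members C
  ∈-triples⁻ Cs t∈ with find (∈-concatMap⁻ _ {xs = Cs} t∈)
  ... | C , C∈ , t∈C with find (∈-concatMap⁻ _ {xs = members C} t∈C)
  ...   | x , x∈ , t∈x with ∈-map⁻ (λ z → (C , x , z)) t∈x
  ...     | z , z∈ , refl = C∈ , x∈ , ∈-filter⁻ _ z∈

module Transport (L : ℕ) (A B : List Point) (a₀ : Point) (a₀∈A : a₀ ∈ A)
                 (boxA : All (InBox (2 ^ L)) A) (boxB : All (InBox (2 ^ L)) B)
                 (sameSize : length A ≡ length B)
                 (disjoint : All (λ p → p ∉ B) A)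
                 (Y : ℕ) (bound : GridBound L A B Y) where

  open GridBound bound

  Δ : ℕ
  Δ = 2 ^ L

  n : ℕ
  n = length A

  sites : List Point
  sites = deduplicate _≟P_ A

  sites-unique : Unique sites
  sites-unique = deduplicate-! _≟P_ A

  A⊆sites : ∀ {a} → a ∈ A → a ∈ sites
  A⊆sites = ∈-deduplicate⁺ _≟P_

  sites⊆A : ∀ {z} → z ∈ sites → z ∈ A
  sites⊆A = ∈-deduplicate⁻ _≟P_ A

  a₀∈sites : a₀ ∈ sites
  a₀∈sites = A⊆sites a₀∈A

  site-inBox : ∀ {z} → z ∈ sites → InBox Δ z
  site-inBox = All.lookup boxA ∘ sites⊆A

  nearest : Point → Point
  nearest b = argmin (dist b) a₀ sites

  nearest∈sites : ∀ b → nearest b ∈ sites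
  nearest∈sites b = ∈-absorb a₀∈sites (argmin∈ (dist b) a₀ sites)

  ρ : Point → ℕ
  ρ b = dist b (nearest b)

  ρ-minimal : ∀ b {z} → z ∈ sites → ρ b ≤ dist b z
  ρ-minimal b z∈ = argmin≤ (dist b) a₀ sites (there z∈)

  ρ<2Δ : ∀ {b} → b ∈ B → ρ b < 2 * Δ
  ρ<2Δ {b} b∈ = ≤-<-trans (ρ-minimal b a₀∈sites) (dist<2Δ Δ b a₀ (All.lookup boxB b∈) (All.lookup boxA a₀∈A))

  -- at level 0 every point is alone in its cell, so n ≤ Y
  n≤Y : n ≤ Y
  n≤Y = ≤-trans (≤-reflexive (sym (*-identityˡ n))) (level 0 n z≤n n≤gridDiff)
    where
    apart : ∀ {a b} → a ∈ A → b ∈ B → true ≢ false → 2 * 2 ^ 0 ≤ suc (dist a b)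
    apart {a} {b} a∈ b∈ _ = s≤s (n≢0⇒n>0 (λ d≡0 → All.lookup disjoint a∈ (subst (_∈ B) (sym (dist≡0⇒≡ a b d≡0)) b∈)))
    n≤gridDiff : ∀ sh → n ≤ gridDiff Δ 0 sh A B
    n≤gridDiff sh = subst (_≤ gridDiff Δ 0 sh A B) imbalance≡n
      (separation Δ 0 sh A B boxA boxB (λ _ → true) (λ _ → false) (λ _ _ different → ⊥-elim (different refl)) apart)
      where
      imbalance≡n : ∣ count (λ _ → true) A - count (λ _ → false) B ∣ ≡ n
      imbalance≡n = trans (cong₂ ∣_-_∣ (count-true _ A (λ _ → refl)) (count-false _ B (λ _ → refl))) (∣-∣-identityʳ n)

  -- the points of B farther than 2·2^i from every site are seen at level i
  far : ℕ → ℕ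
  far i = count (λ b → does (2 * 2 ^ i ≤? ρ b)) B

  far≤gridDiff : ∀ i sh → far i ≤ gridDiff Δ i sh A B
  far≤gridDiff i sh = subst (_≤ gridDiff Δ i sh A B) imbalance≡far
    (separation Δ i sh A B boxA boxB (λ _ → true) nearBy (λ _ _ different → ⊥-elim (different refl)) apart)
    where
    nearBy : Point → Bool
    nearBy b = not (does (2 * 2 ^ i ≤? ρ b))
    apart : ∀ {a b} → a ∈ A → b ∈ B → true ≢ not (does (2 * 2 ^ i ≤? ρ b)) → 2 * 2 ^ i ≤ suc (dist a b)
    apart {a} {b} a∈ b∈ true≢nearBy =
      ≤-trans (isFar (2 * 2 ^ i ≤? ρ b) true≢nearBy)
              (≤-trans (ρ-minimal b (A⊆sites a∈)) (≤-trans (≤-reflexive (dist-sym b a)) (n≤1+n _)))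
      where
      isFar : ∀ {P} (p? : Dec P) → true ≢ not (does p?) → P
      isFar (yes p) _        = p
      isFar (no _)  true≢true = ⊥-elim (true≢true refl)
    imbalance≡far : ∣ count (λ _ → true) A - count nearBy B ∣ ≡ far i
    imbalance≡far = begin
      ∣ count (λ _ → true) A - count nearBy B ∣ ≡⟨ cong (λ m → ∣ m - count nearBy B ∣)
                                                     (trans (count-true _ A (λ _ → refl)) (trans sameSize (sym (count-not _ B)))) ⟩
      ∣ count nearBy B + far i - count nearBy B ∣ ≡⟨ ∣-∣-comm (count nearBy B + far i) _ ⟩
      ∣ count nearBy B - count nearBy B + far i ∣ ≡⟨ ∣m-m+n∣≡n (count nearBy B) (far i) ⟩
      far i ∎
      where open ≡-Reasoning

  ρ-total : sumOf ρ B ≤ 3 * Y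
  ρ-total = begin
    sumOf ρ B                                                ≤⟨ layerCake L ρ B ρ<2Δ ⟩
    2 * sumOf (λ i → 2 ^ i * far i) (upTo (suc L)) + length B ≤⟨ +-mono-≤ (*-monoʳ-≤ 2 (total far (λ i _ → far≤gridDiff i)))
                                                                           (≤-trans (≤-reflexive (sym sameSize)) n≤Y) ⟩
    2 * Y + Y                                                ≡⟨ triple Y ⟩
    3 * Y                                                    ∎
    where
    open ≤-Reasoning
    triple : ∀ y → 2 * y + y ≡ 3 * y
    triple = solve-∀

  inA inB : List Point → ℕ
  inA Q = count (λ a → does (a ∈? Q)) A
  inB Q = count (λ b → does (nearest b ∈? Q)) B

  -- the imbalance of Q: how many points must cross the boundary of Q
  imbalance : List Point → ℕ
  imbalance Q = ∣ inA Q - inB Q ∣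

  imbalance≤n : ∀ Q → imbalance Q ≤ n
  imbalance≤n Q = ≤-trans (∣m-n∣≤m⊔n (inA Q) (inB Q))
                          (⊔-lub (count≤length _ A) (≤-trans (count≤length _ B) (≤-reflexive (sym sameSize))))

  nearest-close : ∀ {a} b → a ∈ A → dist a (nearest b) ≤ 2 * dist a b
  nearest-close {a} b a∈ = begin
    dist a (nearest b)        ≤⟨ dist-tri a b (nearest b) ⟩
    dist a b + ρ b            ≤⟨ +-monoʳ-≤ (dist a b) (≤-trans (ρ-minimal b (A⊆sites a∈)) (≤-reflexive (dist-sym b a))) ⟩
    dist a b + dist a b       ≡⟨ cong (dist a b +_) (sym (+-identityʳ _)) ⟩
    2 * dist a b              ∎
    where open ≤-Reasoning

  -- if the sites in Q are at distance ≥ δ from all other sites, the imbalance of Q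
  -- is seen by the grids at the dyadic scale of δ, so imbalance Q · δ ≤ 8Y
  separated-imbalance : ∀ Q δ → δ < 2 * Δ → (∀ {q z} → q ∈ Q → z ∈ sites → z ∉ Q → δ ≤ dist q z) →
                        imbalance Q * δ ≤ 8 * Y
  separated-imbalance Q δ δ<2Δ sep =
    scale-bound L Y (imbalance Q) δ δ<2Δ (≤-trans (imbalance≤n Q) n≤Y) (λ j j≤L lower → level j (imbalance Q) j≤L (seen j lower))
    where
    seen : ∀ j → 4 * 2 ^ j ≤ δ → ∀ sh → imbalance Q ≤ gridDiff Δ j sh A B
    seen j lower sh = separation Δ j sh A B boxA boxB (λ a → does (a ∈? Q)) (λ b → does (nearest b ∈? Q)) sepAA sepAB
      where
      halfway : ∀ {d} → δ ≤ 2 * d → 2 * 2 ^ j ≤ suc d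
      halfway {d} δ≤2d = ≤-trans (*-cancelˡ-≤ 2 (≤-trans (≤-reflexive (quadruple (2 ^ j))) (≤-trans lower δ≤2d))) (n≤1+n d)
        where
        quadruple : ∀ a → 2 * (2 * a) ≡ 4 * a
        quadruple = solve-∀
      ≤twice : ∀ d → d ≤ 2 * d
      ≤twice d = m≤m+n d (d + 0)
      sepAA : ∀ {a a'} → a ∈ A → a' ∈ A → does (a ∈? Q) ≢ does (a' ∈? Q) → 2 * 2 ^ j ≤ suc (dist a a')
      sepAA {a} {a'} a∈ a'∈ differ = [ (λ (a∈Q , a'∉Q) → halfway (≤-trans (sep a∈Q (A⊆sites a'∈) a'∉Q) (≤twice _)))
                                      , (λ (a'∈Q , a∉Q) → halfway (≤-trans (sep a'∈Q (A⊆sites a∈) a∉Q)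
                                                                          (≤-trans (≤-reflexive (dist-sym a' a)) (≤twice _))))
                                      ]′ (decisions-differ (a ∈? Q) (a' ∈? Q) differ)
      sepAB : ∀ {a b} → a ∈ A → b ∈ B → does (a ∈? Q) ≢ does (nearest b ∈? Q) → 2 * 2 ^ j ≤ suc (dist a b)
      sepAB {a} {b} a∈ b∈ differ = [ (λ (a∈Q , b↦∉Q) → halfway (≤-trans (sep a∈Q (nearest∈sites b) b↦∉Q) (nearest-close b a∈)))
                                    , (λ (b↦∈Q , a∉Q) → halfway (≤-trans (sep b↦∈Q (A⊆sites a∈) a∉Q)
                                                                        (≤-trans (≤-reflexive (dist-sym (nearest b) a)) (nearest-close b a∈))))
                                    ]′ (decisions-differ (a ∈? Q) (nearest b ∈? Q) differ)

  -- A cluster is a set of sites together with the points assigned to it that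
  -- are not matched yet: points of A located at its sites, and points of B
  -- whose nearest site is one of its sites.
  record Cluster : Set where
    constructor cluster
    field
      members : List Point
      restA   : List Point
      restB   : List Point
  open Cluster

  k : ℕ
  k = length sites

  -- the cost allowance of one merge
  K : ℕ
  K = (k ∸ 1) * (8 * Y)

  -- The invariant of single-linkage clustering at scale δ, with matching M:
  -- the clusters partition the sites, are δ-separated and have diameter at most
  -- (size - 1)·δ; the matched and the unmatched points make up A and B; each
  -- cluster has unmatched points on one side only, as many as its imbalance;
  -- and the cost spent so far leaves an allowance K per remaining cluster.
  record Invariant (Cs : List Cluster) (M : Matching) (δ : ℕ) : Set where
    field
      partition    : concatMap members Cs ↭ sites
      coverA       : map proj₁ M ++ concatMap restA Cs ↭ A
      coverB       : map proj₂ M ++ concatMap restB Cs ↭ B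
      nonempty     : ∀ {C} → C ∈ Cs → 1 ≤ length (members C)
      separated    : ∀ {C} → C ∈ Cs → ∀ {x z} → x ∈ members C → z ∈ sites → z ∉ members C → δ ≤ dist x z
      diameter     : ∀ {C} → C ∈ Cs → ∀ {x y} → x ∈ members C → y ∈ members C →
                     dist x y ≤ (length (members C) ∸ 1) * δ
      one-sided    : ∀ {C} → C ∈ Cs → restA C ≡ [] ⊎ restB C ≡ []
      balanced     : ∀ {C} → C ∈ Cs → length (restA C) + inB (members C) ≡ length (restB C) + inA (members C)
      restA-inside : ∀ {C} → C ∈ Cs → All (_∈ members C) (restA C)
      restB-inside : ∀ {C} → C ∈ Cs → All (λ b → nearest b ∈ members C) (restB C)
      budget       : cost M + sumOf ρ (concatMap restB Cs) + length Cs * K ≤ sumOf ρ B + k * K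

  -- Initially every site is a cluster of its own, and at each site the points
  -- of A there are matched with the points of B nearest to it, as far as possible.
  atA toB : Point → List Point
  atA = classOf _≟P_ (λ a → a) A
  toB = classOf _≟P_ nearest B

  pairsAt : Point → Matching
  pairsAt ℓ = zip (atA ℓ) (toB ℓ)

  singleton : Point → Cluster
  singleton ℓ = cluster [ ℓ ] (drop (length (toB ℓ)) (atA ℓ)) (drop (length (atA ℓ)) (toB ℓ))

  M₀ : Matching
  M₀ = concatMap pairsAt sites

  -- each initial pair joins a point b of B with its nearest site, at cost ρ b
  cost-M₀ : cost M₀ ≡ sumOf ρ (map proj₂ M₀)
  cost-M₀ = trans (sumOf-cong _ (ρ ∘ proj₂) M₀ pair-cost) (sym (sumOf-map ρ proj₂ M₀))
    where
    pair-cost : ∀ {p} → p ∈ M₀ → dist (proj₁ p) (proj₂ p) ≡ ρ (proj₂ p)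
    pair-cost {a , b} p∈ =
      let ℓ , ab∈ = Any.satisfied (∈-concatMap⁻ pairsAt {xs = sites} p∈)
          a∈ , b∈ = ∈-zip⁻ ab∈
          a≡ℓ     = proj₂ (∈-filter⁻ (λ x → x ≟P ℓ) {xs = A} a∈)
          b↦ℓ     = proj₂ (∈-filter⁻ (λ x → nearest x ≟P ℓ) {xs = B} b∈)
      in trans (cong (λ z → dist z b) (trans a≡ℓ (sym b↦ℓ))) (dist-sym (nearest b) b)

  coverA₀ : map proj₁ M₀ ++ concatMap restA (map singleton sites) ↭ A
  coverA₀ = ↭-trans (↭-reflexive (cong₂ _++_ (map-concatMap proj₁ pairsAt sites) (concatMap-map restA singleton sites)))
                    (↭-trans (concatMap-split (map proj₁ ∘ pairsAt) (restA ∘ singleton) atA sites (λ ℓ → zip-drop₁ (atA ℓ) (toB ℓ)))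
                             (distribute _≟P_ (λ a → a) sites A sites-unique (All.tabulate A⊆sites)))

  coverB₀ : map proj₂ M₀ ++ concatMap restB (map singleton sites) ↭ B
  coverB₀ = ↭-trans (↭-reflexive (cong₂ _++_ (map-concatMap proj₂ pairsAt sites) (concatMap-map restB singleton sites)))
                    (↭-trans (concatMap-split (map proj₂ ∘ pairsAt) (restB ∘ singleton) toB sites (λ ℓ → zip-drop₂ (atA ℓ) (toB ℓ)))
                             (distribute _≟P_ nearest sites B sites-unique (All.tabulate (λ {b} _ → nearest∈sites b))))

  balanced₀ : ∀ ℓ → length (restA (singleton ℓ)) + inB [ ℓ ] ≡ length (restB (singleton ℓ)) + inA [ ℓ ]
  balanced₀ ℓ = begin
    length rA + inB [ ℓ ]                      ≡⟨ cong (length rA +_) (length-classOf _≟P_ nearest B ℓ) ⟨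
    length rA + length (toB ℓ)                 ≡⟨ cong (length rA +_) (length-zip-drop₂ (atA ℓ) (toB ℓ)) ⟨
    length rA + (length (pairsAt ℓ) + length rB) ≡⟨ exchange (length rA) (length (pairsAt ℓ)) (length rB) ⟩
    length rB + (length (pairsAt ℓ) + length rA) ≡⟨ cong (length rB +_) (length-zip-drop₁ (atA ℓ) (toB ℓ)) ⟩
    length rB + length (atA ℓ)                 ≡⟨ cong (length rB +_) (length-classOf _≟P_ (λ a → a) A ℓ) ⟩
    length rB + inA [ ℓ ]                      ∎
    where
    open ≡-Reasoning
    rA rB : List Point
    rA = restA (singleton ℓ)
    rB = restB (singleton ℓ)
    exchange : ∀ a m b → a + (m + b) ≡ b + (m + a)
    exchange = solve-∀

  restA-inside₀ : ∀ ℓ → All (_∈ [ ℓ ]) (restA (singleton ℓ))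
  restA-inside₀ ℓ = All.tabulate (λ a∈ → here (proj₂ (∈-filter⁻ (λ x → x ≟P ℓ) {xs = A} (∈-drop (length (toB ℓ)) a∈))))

  restB-inside₀ : ∀ ℓ → All (λ b → nearest b ∈ [ ℓ ]) (restB (singleton ℓ))
  restB-inside₀ ℓ = All.tabulate (λ b∈ → here (proj₂ (∈-filter⁻ (λ x → nearest x ≟P ℓ) {xs = B} (∈-drop (length (atA ℓ)) b∈))))

  diameter₀ : ∀ ℓ {x y} → x ∈ [ ℓ ] → y ∈ [ ℓ ] → dist x y ≤ 0
  diameter₀ ℓ (here refl) (here refl) = ≤-reflexive (dist-self ℓ)

  initial : Invariant (map singleton sites) M₀ 0
  initial = record
    { partition    = ↭-reflexive (trans (concatMap-map members singleton sites) (concatMap-pure sites))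
    ; coverA       = coverA₀
    ; coverB       = coverB₀
    ; nonempty     = onSingletons (λ C → 1 ≤ length (members C)) (λ _ → s≤s z≤n)
    ; separated    = λ _ _ _ _ → z≤n
    ; diameter     = λ {C} → onSingletons (λ C → ∀ {x y} → x ∈ members C → y ∈ members C → dist x y ≤ (length (members C) ∸ 1) * 0)
                                          (λ ℓ → diameter₀ ℓ) {C}
    ; one-sided    = onSingletons (λ C → restA C ≡ [] ⊎ restB C ≡ []) (λ ℓ → zip-drop-either (atA ℓ) (toB ℓ))
    ; balanced     = onSingletons (λ C → length (restA C) + inB (members C) ≡ length (restB C) + inA (members C)) balanced₀
    ; restA-inside = onSingletons (λ C → All (_∈ members C) (restA C)) restA-inside₀
    ; restB-inside = onSingletons (λ C → All (λ b → nearest b ∈ members C) (restB C)) restB-inside₀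
    ; budget       = ≤-reflexive (cong₂ _+_ total₀ (cong (_* K) (length-map singleton sites)))
    }
    where
    onSingletons : ∀ (P : Cluster → Set) → (∀ ℓ → P (singleton ℓ)) → ∀ {C} → C ∈ map singleton sites → P C
    onSingletons P P-singleton C∈ = let ℓ , _ , C≡ = ∈-map⁻ singleton C∈ in subst P (sym C≡) (P-singleton ℓ)
    total₀ : cost M₀ + sumOf ρ (concatMap restB (map singleton sites)) ≡ sumOf ρ B
    total₀ = begin
      cost M₀ + sumOf ρ R₀                  ≡⟨ cong (_+ sumOf ρ R₀) cost-M₀ ⟩
      sumOf ρ (map proj₂ M₀) + sumOf ρ R₀   ≡⟨ sumOf-++ ρ (map proj₂ M₀) R₀ ⟨
      sumOf ρ (map proj₂ M₀ ++ R₀)          ≡⟨ sumOf-↭ ρ coverB₀ ⟩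
      sumOf ρ B                             ∎
      where
      open ≡-Reasoning
      R₀ : List Point
      R₀ = concatMap restB (map singleton sites)

  -- Merging the cluster Q with the cluster P containing the site y nearest to Q.
  -- The new cluster N pairs up the unmatched points of Q and P as far as possible.
  module Merge (Cs : List Cluster) (M : Matching) (δ₀ : ℕ) (I : Invariant Cs M δ₀)
               (Q P : Cluster) (rest : List Cluster) (σ : Cs ↭ Q ∷ P ∷ rest)
               (q y : Point) (q∈Q : q ∈ members Q) (y∈P : y ∈ members P) (y∈sites : y ∈ sites) (y∉Q : y ∉ members Q)
               (closest : ∀ {C x z} → C ∈ Cs → x ∈ members C → z ∈ sites → z ∉ members C → dist q y ≤ dist x z) where

    open Invariant I

    δ : ℕ
    δ = dist q y

    inCs : ∀ {C} → C ∈ Q ∷ P ∷ rest → C ∈ Cs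
    inCs = Perm.∈-resp-↭ (↭-sym σ)

    Q∈ : Q ∈ Cs
    Q∈ = inCs (here refl)

    P∈ : P ∈ Cs
    P∈ = inCs (there (here refl))

    rest⊆ : ∀ {C} → C ∈ rest → C ∈ Cs
    rest⊆ = inCs ∘ there ∘ there

    δ₀≤δ : δ₀ ≤ δ
    δ₀≤δ = separated Q∈ q∈Q y∈sites y∉Q

    XA XB : List Point
    XA = restA Q ++ restA P
    XB = restB Q ++ restB P

    ps : Matching
    ps = zip XA XB

    N : Cluster
    N = cluster (members Q ++ members P) (drop (length XB) XA) (drop (length XA) XB)

    sites↭ : members Q ++ members P ++ concatMap members rest ↭ sites
    sites↭ = ↭-trans (concatMap-↭ members (↭-sym σ)) partition

    Q#P : Disjoint (members Q) (members P)
    Q#P (v∈Q , v∈P) = Unique-++-disjoint (members Q) (Unique-resp-↭ (↭-sym sites↭) sites-unique) (v∈Q , ∈-++⁺ˡ v∈P)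

    merged-cover : ∀ (side : Point × Point → Point) (part : Cluster → List Point) (left : List Point) {S} →
                   map side ps ++ left ≡ part Q ++ part P → map side M ++ concatMap part Cs ↭ S →
                   map side (M ++ ps) ++ (left ++ concatMap part rest) ↭ S
    merged-cover side part left {S} split cover = begin
      map side (M ++ ps) ++ (left ++ R)               ≡⟨ cong (_++ (left ++ R)) (map-++ side M ps) ⟩
      (map side M ++ map side ps) ++ (left ++ R)      ≡⟨ ++-assoc (map side M) (map side ps) (left ++ R) ⟩
      map side M ++ (map side ps ++ (left ++ R))      ≡⟨ cong (map side M ++_) (++-assoc (map side ps) left R) ⟨
      map side M ++ ((map side ps ++ left) ++ R)      ≡⟨ cong (λ X → map side M ++ (X ++ R)) split ⟩
      map side M ++ ((part Q ++ part P) ++ R)         ≡⟨ cong (map side M ++_) (++-assoc (part Q) (part P) R) ⟩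
      map side M ++ concatMap part (Q ∷ P ∷ rest)     ↭⟨ Perm.++⁺ˡ (map side M) (concatMap-↭ part (↭-sym σ)) ⟩
      map side M ++ concatMap part Cs                 ↭⟨ cover ⟩
      S                                               ∎
      where
      open PermutationReasoning
      R : List Point
      R = concatMap part rest

    coverA' : map proj₁ (M ++ ps) ++ concatMap restA (N ∷ rest) ↭ A
    coverA' = merged-cover proj₁ restA (restA N) (zip-drop₁ XA XB) coverA

    coverB' : map proj₂ (M ++ ps) ++ concatMap restB (N ∷ rest) ↭ B
    coverB' = merged-cover proj₂ restB (restB N) (zip-drop₂ XA XB) coverB

    partition' : concatMap members (N ∷ rest) ↭ sites
    partition' = ↭-trans (↭-reflexive (++-assoc (members Q) (members P) _)) sites↭

    -- every cluster stays δ-separated, as no pair across clusters was closer than q, y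
    separated' : ∀ {C} → C ∈ N ∷ rest → ∀ {x z} → x ∈ members C → z ∈ sites → z ∉ members C → δ ≤ dist x z
    separated' (here refl) x∈ z∈ z∉ =
      [ (λ x∈Q → closest Q∈ x∈Q z∈ (z∉ ∘ ∈-++⁺ˡ))
      , (λ x∈P → closest P∈ x∈P z∈ (z∉ ∘ ∈-++⁺ʳ (members Q)))
      ]′ (∈-++⁻ (members Q) x∈)
    separated' (there C∈) = closest (rest⊆ C∈)

    nonempty' : ∀ {C} → C ∈ N ∷ rest → 1 ≤ length (members C)
    nonempty' (here refl) = ≤-trans (nonempty Q∈) (length-++-≤ˡ (members Q))
    nonempty' (there C∈)  = nonempty (rest⊆ C∈)

    a b : ℕ
    a = length (members Q)
    b = length (members P)

    -- a path inside Q, along the edge q y, and inside P bounds the diameter of N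
    diam : ℕ
    diam = (a + b ∸ 1) * δ

    inQ : ∀ {x x'} → x ∈ members Q → x' ∈ members Q → dist x x' ≤ (a ∸ 1) * δ
    inQ x∈ x'∈ = ≤-trans (diameter Q∈ x∈ x'∈) (*-monoʳ-≤ (a ∸ 1) δ₀≤δ)

    inP : ∀ {x x'} → x ∈ members P → x' ∈ members P → dist x x' ≤ (b ∸ 1) * δ
    inP x∈ x'∈ = ≤-trans (diameter P∈ x∈ x'∈) (*-monoʳ-≤ (b ∸ 1) δ₀≤δ)

    across : ∀ {x x'} → x ∈ members Q → x' ∈ members P → dist x x' ≤ diam
    across {x} {x'} x∈ x'∈ = begin
      dist x x'                          ≤⟨ dist-tri x q x' ⟩
      dist x q + dist q x'               ≤⟨ +-monoʳ-≤ (dist x q) (dist-tri q y x') ⟩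
      dist x q + (δ + dist y x')         ≤⟨ +-mono-≤ (inQ x∈ q∈Q) (+-monoʳ-≤ δ (inP y∈P x'∈)) ⟩
      (a ∸ 1) * δ + (δ + (b ∸ 1) * δ)    ≡⟨ merge-diameter a b δ (nonempty Q∈) (nonempty P∈) ⟩
      diam                               ∎
      where open ≤-Reasoning

    diameterN : ∀ {x x'} → x ∈ members Q ⊎ x ∈ members P → x' ∈ members Q ⊎ x' ∈ members P → dist x x' ≤ diam
    diameterN (inj₁ x∈Q) (inj₁ x'∈Q) = ≤-trans (inQ x∈Q x'∈Q) (*-monoˡ-≤ δ (∸-monoˡ-≤ 1 (m≤m+n a b)))
    diameterN (inj₁ x∈Q) (inj₂ x'∈P) = across x∈Q x'∈P
    diameterN {x} {x'} (inj₂ x∈P) (inj₁ x'∈Q) = ≤-trans (≤-reflexive (dist-sym x x')) (across x'∈Q x∈P)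
    diameterN (inj₂ x∈P) (inj₂ x'∈P) = ≤-trans (inP x∈P x'∈P) (*-monoˡ-≤ δ (∸-monoˡ-≤ 1 (m≤n+m b a)))

    diameter' : ∀ {C} → C ∈ N ∷ rest → ∀ {x x'} → x ∈ members C → x' ∈ members C → dist x x' ≤ (length (members C) ∸ 1) * δ
    diameter' (here refl) {x} {x'} x∈ x'∈ = subst (λ s → dist x x' ≤ (s ∸ 1) * δ) (sym (length-++ (members Q)))
                                                  (diameterN (∈-++⁻ (members Q) x∈) (∈-++⁻ (members Q) x'∈))
    diameter' {C} (there C∈) x∈ x'∈ = ≤-trans (diameter (rest⊆ C∈) x∈ x'∈) (*-monoʳ-≤ (length (members C) ∸ 1) δ₀≤δ)

    one-sided' : ∀ {C} → C ∈ N ∷ rest → restA C ≡ [] ⊎ restB C ≡ []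
    one-sided' (here refl) = zip-drop-either XA XB
    one-sided' (there C∈)  = one-sided (rest⊆ C∈)

    XA-inside : ∀ {x} → x ∈ XA → x ∈ members Q ++ members P
    XA-inside x∈ = [ (λ x∈Q → ∈-++⁺ˡ (All.lookup (restA-inside Q∈) x∈Q))
                   , (λ x∈P → ∈-++⁺ʳ (members Q) (All.lookup (restA-inside P∈) x∈P))
                   ]′
                   (∈-++⁻ (restA Q) x∈)

    XB-inside : ∀ {x} → x ∈ XB → nearest x ∈ members Q ++ members P
    XB-inside x∈ = [ (λ x∈Q → ∈-++⁺ˡ (All.lookup (restB-inside Q∈) x∈Q))
                   , (λ x∈P → ∈-++⁺ʳ (members Q) (All.lookup (restB-inside P∈) x∈P))
                   ]′
                   (∈-++⁻ (restB Q) x∈)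

    restA-inside' : ∀ {C} → C ∈ N ∷ rest → All (_∈ members C) (restA C)
    restA-inside' (here refl) = All.tabulate (XA-inside ∘ ∈-drop (length XB))
    restA-inside' (there C∈)  = restA-inside (rest⊆ C∈)

    restB-inside' : ∀ {C} → C ∈ N ∷ rest → All (λ b → nearest b ∈ members C) (restB C)
    restB-inside' (here refl) = All.tabulate (XB-inside ∘ ∈-drop (length XA))
    restB-inside' (there C∈)  = restB-inside (rest⊆ C∈)

    balanced' : ∀ {C} → C ∈ N ∷ rest → length (restA C) + inB (members C) ≡ length (restB C) + inA (members C)
    balanced' (here refl) = begin
      length (restA N) + inB (members Q ++ members P)       ≡⟨ cong (length (restA N) +_) (count-∈?-++ _≟P_ nearest (members Q) (members P) B Q#P) ⟩
      length (restA N) + (inB (members Q) + inB (members P)) ≡⟨ merge-balance (length ps) (length (restA N)) (length (restB N))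
                                                                  (length (restA Q)) (length (restA P)) (length (restB Q)) (length (restB P))
                                                                  (inB (members Q)) (inB (members P)) (inA (members Q)) (inA (members P))
                                                                (trans (length-zip-drop₁ XA XB) (length-++ (restA Q)))
                                                                (trans (length-zip-drop₂ XA XB) (length-++ (restB Q)))
                                                                (balanced Q∈) (balanced P∈) ⟩
      length (restB N) + (inA (members Q) + inA (members P)) ≡⟨ cong (length (restB N) +_) (count-∈?-++ _≟P_ (λ a → a) (members Q) (members P) A Q#P) ⟨
      length (restB N) + inA (members Q ++ members P)       ∎
      where open ≡-Reasoning
    balanced' (there C∈) = balanced (rest⊆ C∈)

    surplus-size : ∀ {C} → C ∈ Cs → length (restA C) + length (restB C) ≡ imbalance (members C)
    surplus-size C∈ = one-sided-size _ _ _ _ (Sum.map (cong length) (cong length) (one-sided C∈)) (balanced C∈)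

    -- at most imbalance(Q) pairs are formed, since P has a surplus on one side only
    pairs≤imbalance : length ps ≤ imbalance (members Q)
    pairs≤imbalance = ≤-trans bounded (≤-reflexive (surplus-size Q∈))
      where
      bounded : length ps ≤ length (restA Q) + length (restB Q)
      bounded = [ (λ noA → begin
                     length ps                              ≤⟨ ≤-trans (≤-reflexive (length-zipWith _,_ XA XB)) (m⊓n≤m _ _) ⟩
                     length XA                              ≡⟨ length-++ (restA Q) ⟩
                     length (restA Q) + length (restA P)    ≡⟨ cong (λ xs → length (restA Q) + length xs) noA ⟩
                     length (restA Q) + 0                   ≤⟨ +-monoʳ-≤ (length (restA Q)) z≤n ⟩
                     length (restA Q) + length (restB Q)    ∎)
                 , (λ noB → begin
                     length ps                              ≤⟨ ≤-trans (≤-reflexive (length-zipWith _,_ XA XB)) (m⊓n≤n _ _) ⟩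
                     length XB                              ≡⟨ length-++ (restB Q) ⟩
                     length (restB Q) + length (restB P)    ≡⟨ cong (λ xs → length (restB Q) + length xs) noB ⟩
                     length (restB Q) + 0                   ≤⟨ +-monoˡ-≤ 0 (m≤n+m (length (restB Q)) (length (restA Q))) ⟩
                     length (restA Q) + length (restB Q) + 0 ≡⟨ +-identityʳ _ ⟩
                     length (restA Q) + length (restB Q)    ∎)
                 ]′ (one-sided P∈)
        where open ≤-Reasoning

    q∈sites : q ∈ sites
    q∈sites = Perm.∈-resp-↭ sites↭ (∈-++⁺ˡ q∈Q)

    a+b≤k : a + b ≤ k
    a+b≤k = begin
      a + b                                              ≤⟨ +-monoʳ-≤ a (m≤m+n b _) ⟩
      a + (b + length (concatMap members rest))          ≡⟨ cong (a +_) (length-++ (members P)) ⟨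
      a + length (members P ++ concatMap members rest)   ≡⟨ length-++ (members Q) ⟨
      length (concatMap members (Q ∷ P ∷ rest))          ≡⟨ Perm.↭-length sites↭ ⟩
      k                                                  ∎
      where open ≤-Reasoning

    pairs-cost : cost ps ≤ sumOf ρ (map proj₂ ps) + K
    pairs-cost = begin
      cost ps                                          ≤⟨ sumOf-mono _ (λ p → diam + ρ (proj₂ p)) ps pair≤ ⟩
      sumOf (λ p → diam + ρ (proj₂ p)) ps              ≡⟨ sumOf-+ (λ _ → diam) (ρ ∘ proj₂) ps ⟩
      sumOf (λ _ → diam) ps + sumOf (ρ ∘ proj₂) ps     ≡⟨ cong₂ _+_ (sumOf-const diam ps) (sym (sumOf-map ρ proj₂ ps)) ⟩
      length ps * diam + sumOf ρ (map proj₂ ps)        ≤⟨ +-monoˡ-≤ _ pairs·diam≤K ⟩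
      K + sumOf ρ (map proj₂ ps)                       ≡⟨ +-comm K _ ⟩
      sumOf ρ (map proj₂ ps) + K                       ∎
      where
      open ≤-Reasoning
      pair≤ : ∀ {p} → p ∈ ps → dist (proj₁ p) (proj₂ p) ≤ diam + ρ (proj₂ p)
      pair≤ {x , x'} p∈ = let x∈ , x'∈ = ∈-zip⁻ p∈ in begin
        dist x x'                              ≤⟨ dist-tri x (nearest x') x' ⟩
        dist x (nearest x') + dist (nearest x') x' ≤⟨ +-mono-≤ (diameterN (∈-++⁻ (members Q) (XA-inside x∈)) (∈-++⁻ (members Q) (XB-inside x'∈)))
                                                               (≤-reflexive (dist-sym (nearest x') x')) ⟩
        diam + ρ x'                            ∎
      regroup : ∀ m s d → m * (s * d) ≡ s * (m * d)
      regroup = solve-∀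
      pairs·diam≤K : length ps * diam ≤ K
      pairs·diam≤K = begin
        length ps * ((a + b ∸ 1) * δ)     ≡⟨ regroup (length ps) (a + b ∸ 1) δ ⟩
        (a + b ∸ 1) * (length ps * δ)     ≤⟨ *-mono-≤ (∸-monoˡ-≤ 1 a+b≤k)
                                                      (≤-trans (*-monoˡ-≤ δ pairs≤imbalance)
                                                               (separated-imbalance (members Q) δ (dist<2Δ Δ q y (site-inBox q∈sites) (site-inBox y∈sites))
                                                                                    (closest Q∈))) ⟩
        (k ∸ 1) * (8 * Y)                 ∎

    budget' : cost (M ++ ps) + sumOf ρ (concatMap restB (N ∷ rest)) + length (N ∷ rest) * K ≤ sumOf ρ B + k * K
    budget' = subst₂ (λ c r → c + r + suc (length rest) * K ≤ sumOf ρ B + k * K)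
                     (sym (sumOf-++ (λ (x , x') → dist x x') M ps)) (sym (sumOf-++ ρ (restB N) R))
                     (merge-budget (cost M) (cost ps) (sumOf ρ (map proj₂ ps)) (sumOf ρ (restB N)) (sumOf ρ R) K (length rest)
                                   (sumOf ρ B + k * K) pairs-cost
                                   (subst₂ (λ r l → cost M + r + l * K ≤ sumOf ρ B + k * K) unmatched (Perm.↭-length σ) budget))
      where
      R : List Point
      R = concatMap restB rest
      unmatched : sumOf ρ (concatMap restB Cs) ≡ (sumOf ρ (map proj₂ ps) + sumOf ρ (restB N)) + sumOf ρ R
      unmatched = begin
        sumOf ρ (concatMap restB Cs)                            ≡⟨ sumOf-↭ ρ (concatMap-↭ restB σ) ⟩
        sumOf ρ (restB Q ++ (restB P ++ R))                     ≡⟨ cong (sumOf ρ) (++-assoc (restB Q) (restB P) R) ⟨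
        sumOf ρ (XB ++ R)                                       ≡⟨ sumOf-++ ρ XB R ⟩
        sumOf ρ XB + sumOf ρ R                                  ≡⟨ cong (λ X → sumOf ρ X + sumOf ρ R) (zip-drop₂ XA XB) ⟨
        sumOf ρ (map proj₂ ps ++ restB N) + sumOf ρ R           ≡⟨ cong (_+ sumOf ρ R) (sumOf-++ ρ (map proj₂ ps) (restB N)) ⟩
        (sumOf ρ (map proj₂ ps) + sumOf ρ (restB N)) + sumOf ρ R ∎
        where open ≡-Reasoning

    invariant' : Invariant (N ∷ rest) (M ++ ps) δ
    invariant' = record
      { partition = partition' ; coverA = coverA' ; coverB = coverB' ; nonempty = nonempty'
      ; separated = separated' ; diameter = diameter' ; one-sided = one-sided' ; balanced = balanced'
      ; restA-inside = restA-inside' ; restB-inside = restB-inside' ; budget = budget' }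

  ClosestPair : List Cluster → Set
  ClosestPair Cs = ∃ λ Q → ∃₂ λ q y → Q ∈ Cs × q ∈ members Q × y ∈ sites × y ∉ members Q ×
                   (∀ {C x z} → C ∈ Cs → x ∈ members C → z ∈ sites → z ∉ members C → dist q y ≤ dist x z)

  closest-pair : ∀ {M δ} Cs → Invariant Cs M δ → 2 ≤ length Cs → ClosestPair Cs
  closest-pair (_ ∷ []) _ (s≤s ())
  closest-pair (C₁ ∷ C₂ ∷ Cs) I _ =
    let open Invariant I
        x₁ , x₁∈ = nonempty⇒∈ (nonempty (here refl))
        z₂ , z₂∈ = nonempty⇒∈ (nonempty (there (here refl)))
        z₂∈sites = Perm.∈-resp-↭ partition (∈-++⁺ʳ (members C₁) (∈-++⁺ˡ {ys = concatMap members Cs} z₂∈))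
        z₂∉C₁ : z₂ ∉ members C₁
        z₂∉C₁ z₂∈C₁ = Unique-++-disjoint (members C₁) (Unique-resp-↭ (↭-sym partition) sites-unique)
                                         (z₂∈C₁ , ∈-++⁺ˡ {ys = concatMap members Cs} z₂∈)
        (Q , q , y) , t∈ , minimal = minimiser (λ (_ , x , z) → dist x z)
                                               (∈-triples⁺ members sites (C₁ ∷ C₂ ∷ Cs) (here refl) x₁∈ z₂∈sites z₂∉C₁)
        Q∈ , q∈Q , y∈sites , y∉Q = ∈-triples⁻ members sites (C₁ ∷ C₂ ∷ Cs) t∈
    in Q , q , y , Q∈ , q∈Q , y∈sites , y∉Q , λ C∈ x∈ z∈ z∉ → minimal (∈-triples⁺ members sites (C₁ ∷ C₂ ∷ Cs) C∈ x∈ z∈ z∉)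

  cluster-of : ∀ {Cs y} → concatMap members Cs ↭ sites → y ∈ sites → ∃ λ P → P ∈ Cs × y ∈ members P
  cluster-of {Cs} partition y∈ = find (∈-concatMap⁻ members {xs = Cs} (Perm.∈-resp-↭ (↭-sym partition) y∈))

  record Stage (m : ℕ) : Set where
    constructor stage
    field
      clusters  : List Cluster
      matching  : Matching
      scale     : ℕ
      invariant : Invariant clusters matching scale
      size      : length clusters ≡ suc m

  merge-step : ∀ {m} → Stage (suc m) → Stage m
  merge-step (stage Cs M δ₀ I size) =
    let Q , q , y , Q∈ , q∈Q , y∈sites , y∉Q , closest = closest-pair Cs I (≤-trans (s≤s (s≤s z≤n)) (≤-reflexive (sym size)))
        P , P∈ , y∈P = cluster-of (Invariant.partition I) y∈sites
        rest , σ = ↭-front₂ Q∈ P∈ (λ P≡Q → y∉Q (subst (λ C → y ∈ members C) P≡Q y∈P))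
        open Merge Cs M δ₀ I Q P rest σ q y q∈Q y∈P y∈sites y∉Q closest
    in stage (N ∷ rest) (M ++ ps) δ invariant' (suc-injective (trans (sym (Perm.↭-length σ)) size))

  Matches : Matching → Set
  Matches M = map proj₁ M ↭ A × map proj₂ M ↭ B

  last-stage : Stage 0 → ∃ λ M → Matches M × cost M + K ≤ sumOf ρ B + k * K
  last-stage (stage (C ∷ []) M δ I _) = M , (matchesA , matchesB) , cost≤
    where
    open Invariant I
    lengthA : length (map proj₁ M) + length (restA C ++ []) ≡ length A
    lengthA = trans (sym (length-++ (map proj₁ M))) (Perm.↭-length coverA)
    lengthB : length (map proj₂ M) + length (restB C ++ []) ≡ length B
    lengthB = trans (sym (length-++ (map proj₂ M))) (Perm.↭-length coverB)
    empty : restA C ++ [] ≡ [] × restB C ++ [] ≡ []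
    empty = both-empty (Sum.map (λ e → trans (++-identityʳ _) e) (λ e → trans (++-identityʳ _) e) (one-sided (here refl)))
                       (+-cancelˡ-≡ (length M) _ _ (begin
                         length M + length (restA C ++ [])               ≡⟨ cong (_+ _) (length-map proj₁ M) ⟨
                         length (map proj₁ M) + length (restA C ++ [])   ≡⟨ trans lengthA (trans sameSize (sym lengthB)) ⟩
                         length (map proj₂ M) + length (restB C ++ [])   ≡⟨ cong (_+ _) (length-map proj₂ M) ⟩
                         length M + length (restB C ++ [])               ∎))
      where open ≡-Reasoning
    matchesA : map proj₁ M ↭ A
    matchesA = ↭-trans (↭-reflexive (sym (trans (cong (map proj₁ M ++_) (proj₁ empty)) (++-identityʳ _)))) coverA
    matchesB : map proj₂ M ↭ B
    matchesB = ↭-trans (↭-reflexive (sym (trans (cong (map proj₂ M ++_) (proj₂ empty)) (++-identityʳ _)))) coverB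
    cost≤ : cost M + K ≤ sumOf ρ B + k * K
    cost≤ = ≤-trans (+-mono-≤ (m≤m+n (cost M) _) (≤-reflexive (sym (+-identityʳ K)))) budget

  run : ∀ m → Stage m → ∃ λ M → Matches M × cost M + K ≤ sumOf ρ B + k * K
  run zero    s = last-stage s
  run (suc m) s = run m (merge-step s)

  matching-bound : ∃ λ M → Matches M × cost M ≤ 11 * k ^ 2 * Y
  matching-bound =
    let M , matches , budget = run (pred k) (stage (map singleton sites) M₀ 0 initial size₀)
    in M , matches , final-cost k Y (cost M) (sumOf ρ B) 1≤k budget ρ-total
    where
    1≤k : 1 ≤ k
    1≤k = ∈⇒1≤length a₀∈sites
    size₀ : length (map singleton sites) ≡ suc (pred k)
    size₀ = trans (length-map singleton sites) (sym (suc-pred k {{>-nonZero 1≤k}}))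

EMD≤via-S : ∀ L S T {s} → s ∈ S → All (InBox (2 ^ L)) S → All (InBox (2 ^ L)) T → length S ≡ length T →
            All (λ p → p ∉ T) S → ∀ Y → GridBound L S T Y → EMD S T ≤ 11 * distinct S ^ 2 * Y
EMD≤via-S L S T {s} s∈S boxS boxT size disjoint Y bound =
  let M , (M₁↭S , M₂↭T) , cost≤ = Transport.matching-bound L S T s s∈S boxS boxT size disjoint Y bound
  in ≤-trans (EMD≤cost S T M M₁↭S M₂↭T) cost≤

EMD≤via-T : ∀ L S T {t} → t ∈ T → All (InBox (2 ^ L)) S → All (InBox (2 ^ L)) T → length S ≡ length T →
            All (λ p → p ∉ T) S → ∀ Y → GridBound L S T Y → EMD S T ≤ 11 * distinct T ^ 2 * Y
EMD≤via-T L S T {t} t∈T boxS boxT size disjoint Y bound =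
  let M , (M₁↭T , M₂↭S) , cost≤ = Transport.matching-bound L T S t t∈T boxT boxS (sym size)
                                     (All.tabulate (λ t∈ s∈ → All.lookup disjoint s∈ t∈)) Y (GridBound-swap bound)
  in ≤-trans (EMD≤cost-swapped S T M M₁↭T M₂↭S) cost≤

⊓-closed : ∀ (P : ℕ → Set) {m n} → P m → P n → P (m ⊓ n)
⊓-closed P {m} {n} pm pn = [ (λ m⊓n≡m → subst P (sym m⊓n≡m) pm) , (λ m⊓n≡n → subst P (sym m⊓n≡n) pn) ]′ (⊓-sel m n)

InBox1⇒≡ : ∀ {p} → InBox 1 p → p ≡ (1 , 1)
InBox1⇒≡ {x , y} ((1≤x , x≤1) , (1≤y , y≤1)) = cong₂ _,_ (≤-antisym x≤1 1≤x) (≤-antisym y≤1 1≤y)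

lemma2 : ∃[ c ] (∀ (L : ℕ) (S T : List Point)
           → All (InBox (2 ^ L)) S → All (InBox (2 ^ L)) T
           → length S ≡ length T
           → All (λ p → p ∉ T) S
           → (shift : ℕ → ℕ → Shift)
           → EMD S T ≤ c * ((distinct S ⊓ distinct T) ^ 2) * twoY L shift S T)
lemma2 = 11 , bound
  where
  bound : ∀ L S T → All (InBox (2 ^ L)) S → All (InBox (2 ^ L)) T → length S ≡ length T → All (λ p → p ∉ T) S →
          ∀ shift → EMD S T ≤ 11 * ((distinct S ⊓ distinct T) ^ 2) * twoY L shift S T
  bound L       []      []      _    _    _    _        _     = z≤n
  -- with Δ = 1, S and T would share the only point of the box
  bound zero    (s ∷ S) (t ∷ T) boxS boxT _    disjoint _     =
    ⊥-elim (All.lookup disjoint (here refl)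
                       (here (trans (InBox1⇒≡ (All.lookup boxS (here refl))) (sym (InBox1⇒≡ (All.lookup boxT (here refl)))))))
  -- otherwise cluster around either side, and take the better bound
  bound (suc L) (s ∷ S) (t ∷ T) boxS boxT size disjoint shift =
    ⊓-closed (λ k → EMD (s ∷ S) (t ∷ T) ≤ 11 * k ^ 2 * Y) {distinct (s ∷ S)} {distinct (t ∷ T)}
             (EMD≤via-S (suc L) (s ∷ S) (t ∷ T) (here refl) boxS boxT size disjoint Y (twoY-bound L shift (s ∷ S) (t ∷ T)))
             (EMD≤via-T (suc L) (s ∷ S) (t ∷ T) (here refl) boxS boxT size disjoint Y (twoY-bound L shift (s ∷ S) (t ∷ T)))
    where
    Y : ℕ
    Y = twoY (suc L) shift (s ∷ S) (t ∷ T)
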